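{- For $p\in\{102,201\}$, we have $$C_p(x,y)=\frac{1-3x+3x^2-2x^2y-x^3+x^3y}{(1-x)(1-3x+2x^2-2x^2y)}.$$
   Context: A Catalan word of length $n\geq 1$ is a word $w_1\ldots w_n$ over the non-negative integers with $w_1=0$ and $0\leq w_i\leq w_{i-1}+1$ for $2\leq i\leq n$; the empty word is the unique Catalan word of length $0$. A word $w$ contains the pattern $p=p_1\ldots p_k$ if there are indices $i_1<\cdots<i_k$ such that $w_{i_1}\ldots w_{i_k}$ is order-isomorphic to $p$ (for all $a,b$: $w_{i_a}<w_{i_b}$ iff $p_a<p_b$, and $w_{i_a}=w_{i_b}$ iff $p_a=p_b$); otherwise $w$ avoids $p$. $\mathcal{C}_n(p)$ is the set of Catalan words of length $n$ avoiding $p$. A descent of $w$ is an index $i$ with $w_i>w_{i+1}$. $C_p(x,y)=\sum_{n,k\geq 0}c_{n,k}x^ny^k$, where $c_{n,k}$ is the number of words in $\mathcal{C}_n(p)$ with exactly $k$ descents. -}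

module Defs where

open import Data.Nat using (ℕ; zero; suc; _+_; _∸_; _<ᵇ_; _≡ᵇ_; _≤ᵇ_)
open import Data.Bool using (Bool; true; false; _∧_; not; _xor_; if_then_else_)
open import Data.List using (List; []; _∷_; map; _++_; concatMap; length; upTo)
open import Data.Bool.ListAction using (any)
open import Data.Integer as ℤ using (ℤ; +_)
open import Data.Product using (_×_; _,_)

Word : Set
Word = List ℕ

catStep : ℕ → Word → Bool
catStep prev []       = true
catStep prev (y ∷ ys) = (y ≤ᵇ suc prev) ∧ catStep y ys

isCatalan : Word → Bool
isCatalan []       = true
isCatalan (x ∷ xs) = (x ≡ᵇ 0) ∧ catStep x xs

allWords : ℕ → ℕ → List Word
allWords m zero    = [] ∷ []
allWords m (suc n) = concatMap (λ w → map (_∷ w) (upTo m)) (allWords m n)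

filterᵇ : {A : Set} → (A → Bool) → List A → List A
filterᵇ f []       = []
filterᵇ f (x ∷ xs) = if f x then x ∷ filterᵇ f xs else filterᵇ f xs

-- Catalan words of length n (their entries are necessarily < n when n ≥ 1).
catalanWords : ℕ → List Word
catalanWords n = filterᵇ isCatalan (allWords n n)

subseqs : ℕ → Word → List Word
subseqs zero    _        = [] ∷ []
subseqs (suc k) []       = []
subseqs (suc k) (x ∷ xs) = map (x ∷_) (subseqs k xs) ++ subseqs (suc k) xs

_==ᵇ_ : Bool → Bool → Bool
a ==ᵇ b = not (a xor b)

agree : ℕ → ℕ → ℕ → ℕ → Bool
agree a x b y = ((a <ᵇ x) ==ᵇ (b <ᵇ y)) ∧ ((x <ᵇ a) ==ᵇ (y <ᵇ b)) ∧ ((a ≡ᵇ x) ==ᵇ (b ≡ᵇ y))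

agreeAll : ℕ → Word → ℕ → Word → Bool
agreeAll a []       b []       = true
agreeAll a (x ∷ u) b (y ∷ v)  = agree a x b y ∧ agreeAll a u b v
agreeAll a _        b _        = false

orderIso : Word → Word → Bool
orderIso []       []       = true
orderIso (a ∷ u) (b ∷ v)   = agreeAll a u b v ∧ orderIso u v
orderIso _        _        = false

contains : Word → Word → Bool
contains p w = any (orderIso p) (subseqs (length p) w)

avoids : Word → Word → Bool
avoids p w = not (contains p w)

descents : Word → ℕ
descents []            = 0
descents (a ∷ [])      = 0
descents (a ∷ b ∷ r)   = (if b <ᵇ a then 1 else 0) + descents (b ∷ r)

countᵇ : {A : Set} → (A → Bool) → List A → ℕ
countᵇ f xs = length (filterᵇ f xs)

cnk : Word → ℕ → ℕ → ℕ
cnk p n k = countᵇ (λ w → avoids p w ∧ (descents w ≡ᵇ k)) (catalanWords n)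

-- Bivariate polynomials in x,y: list of monomials (a , i , j) meaning a·xⁱyʲ.
Poly : Set
Poly = List (ℤ × ℕ × ℕ)

polyMul : Poly → Poly → Poly
polyMul P Q = concatMap (λ { (a , i , j) → map (λ { (b , k , l) → (a ℤ.* b , i + k , j + l) }) Q }) P

polyCoeff : Poly → ℕ → ℕ → ℤ
polyCoeff []                n k = + 0
polyCoeff ((a , i , j) ∷ P) n k =
  (if (i ≡ᵇ n) ∧ (j ≡ᵇ k) then a else + 0) ℤ.+ polyCoeff P n k

-- coefficient of xⁿyᵏ in P · F, F a formal power series given by its coefficients
mulSeriesCoeff : Poly → (ℕ → ℕ → ℤ) → ℕ → ℕ → ℤ
mulSeriesCoeff []                F n k = + 0
mulSeriesCoeff ((a , i , j) ∷ P) F n k =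
  (if (i ≤ᵇ n) ∧ (j ≤ᵇ k) then a ℤ.* F (n ∸ i) (k ∸ j) else + 0) ℤ.+ mulSeriesCoeff P F n k

numer : Poly
numer = (+ 1 , 0 , 0) ∷ (ℤ.- (+ 3) , 1 , 0) ∷ (+ 3 , 2 , 0) ∷ (ℤ.- (+ 2) , 2 , 1)
      ∷ (ℤ.- (+ 1) , 3 , 0) ∷ (+ 1 , 3 , 1) ∷ []

denom : Poly
denom = polyMul ((+ 1 , 0 , 0) ∷ (ℤ.- (+ 1) , 1 , 0) ∷ [])
                ((+ 1 , 0 , 0) ∷ (ℤ.- (+ 3) , 1 , 0) ∷ (+ 2 , 2 , 0) ∷ (ℤ.- (+ 2) , 2 , 1) ∷ [])

p102 p201 : Word
p102 = 1 ∷ 0 ∷ 2 ∷ []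
p201 = 2 ∷ 0 ∷ 1 ∷ []

-- A Catalan word avoids 102 (resp. 201) exactly when it is accepted by a three-state automaton that
-- compares each letter only with the previous one.  Splitting on the first letter turns the numbers
-- of accepted words into recurrences for families of bivariate series indexed by the previous
-- letter.  Differences of consecutive members of a family satisfy homogeneous recurrences, hence
-- scale by a fixed rational factor from one index to the next; eliminating the index gives
-- D · R = (1 - x)² - x²y for the series R with C = 1 + x R, where D is the denominator, so D · C is
-- the numerator.  Each elimination step is a linear identity over ℤ[x, y] between shifted series,
-- checked by normalisation.

module Submission where

open import Defs

module Counting where

  open import Data.Bool using (Bool; true; false; _∧_; if_then_else_)
  open import Data.List using (List; []; _∷_; _++_; map; concatMap; upTo; [_])
  open import Data.List.Properties using (upTo-∷ʳ)
  open import Data.Nat using (ℕ; zero; suc; _+_; _∸_; _≤_; _<_)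
  open import Data.Nat.Properties
    using (+-identityʳ; +-assoc; +-suc; m+[n∸m]≡n; m<n⇒m<1+n; ≤-refl)
  open import Data.Nat.Tactic.RingSolver using (solve-∀)
  open import Relation.Binary.PropositionalEquality using (_≡_; refl; sym; trans; cong; cong₂; module ≡-Reasoning)

  count : {A : Set} → (A → Bool) → List A → ℕ
  count f []       = 0
  count f (x ∷ xs) = (if f x then 1 else 0) + count f xs

  sumBelow : ℕ → (ℕ → ℕ) → ℕ
  sumBelow zero    f = 0
  sumBelow (suc n) f = sumBelow n f + f n

  countᵇ≡count : {A : Set} (f : A → Bool) (xs : List A) → countᵇ f xs ≡ count f xs
  countᵇ≡count f []       = refl
  countᵇ≡count f (x ∷ xs) with f x
  ... | true  = cong suc (countᵇ≡count f xs)
  ... | false = countᵇ≡count f xs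

  count-filterᵇ : {A : Set} (g f : A → Bool) (xs : List A) →
                  count f (filterᵇ g xs) ≡ count (λ x → g x ∧ f x) xs
  count-filterᵇ g f []       = refl
  count-filterᵇ g f (x ∷ xs) with g x
  ... | true  = cong ((if f x then 1 else 0) +_) (count-filterᵇ g f xs)
  ... | false = count-filterᵇ g f xs

  count-cong : {A : Set} {f g : A → Bool} → (∀ x → f x ≡ g x) → (xs : List A) → count f xs ≡ count g xs
  count-cong f≗g []       = refl
  count-cong f≗g (x ∷ xs) = cong₂ (λ b n → (if b then 1 else 0) + n) (f≗g x) (count-cong f≗g xs)

  count-false : {A : Set} {f : A → Bool} → (∀ x → f x ≡ false) → (xs : List A) → count f xs ≡ 0
  count-false f≗false xs = trans (count-cong f≗false xs) (none xs)
    where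
    none : ∀ xs → count (λ _ → false) xs ≡ 0
    none []       = refl
    none (_ ∷ xs) = none xs

  count-++ : {A : Set} (f : A → Bool) (xs ys : List A) → count f (xs ++ ys) ≡ count f xs + count f ys
  count-++ f []       ys = refl
  count-++ f (x ∷ xs) ys =
    trans (cong ((if f x then 1 else 0) +_) (count-++ f xs ys)) (sym (+-assoc (if f x then 1 else 0) _ _))

  sumBelow-+ : ∀ n (f g : ℕ → ℕ) → sumBelow n (λ i → f i + g i) ≡ sumBelow n f + sumBelow n g
  sumBelow-+ zero    f g = refl
  sumBelow-+ (suc n) f g rewrite sumBelow-+ n f g = interchange (sumBelow n f) (sumBelow n g) (f n) (g n)
    where
    interchange : ∀ a b c d → a + b + (c + d) ≡ a + c + (b + d)
    interchange = solve-∀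

  sumBelow-cong< : ∀ n {f g : ℕ → ℕ} → (∀ i → i < n → f i ≡ g i) → sumBelow n f ≡ sumBelow n g
  sumBelow-cong< zero    f≗g = refl
  sumBelow-cong< (suc n) f≗g =
    cong₂ _+_ (sumBelow-cong< n (λ i i<n → f≗g i (m<n⇒m<1+n i<n))) (f≗g n ≤-refl)

  sumBelow-zero : ∀ n {f : ℕ → ℕ} → (∀ i → i < n → f i ≡ 0) → sumBelow n f ≡ 0
  sumBelow-zero zero    f≗0 = refl
  sumBelow-zero (suc n) f≗0 =
    cong₂ _+_ (sumBelow-zero n (λ i i<n → f≗0 i (m<n⇒m<1+n i<n))) (f≗0 n ≤-refl)

  sumBelow-split : ∀ m n f → sumBelow (m + n) f ≡ sumBelow m f + sumBelow n (λ i → f (m + i))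
  sumBelow-split m zero    f = trans (cong (λ t → sumBelow t f) (+-identityʳ m)) (sym (+-identityʳ _))
  sumBelow-split m (suc n) f rewrite +-suc m n | sumBelow-split m n f = +-assoc (sumBelow m f) _ _

  sumBelow-vanishing : ∀ {t m} f → t ≤ m → (∀ i → f (t + i) ≡ 0) → sumBelow m f ≡ sumBelow t f
  sumBelow-vanishing {t} {m} f t≤m f≗0 = begin
    sumBelow m f                                            ≡⟨ cong (λ n → sumBelow n f) (sym (m+[n∸m]≡n t≤m)) ⟩
    sumBelow (t + (m ∸ t)) f                                ≡⟨ sumBelow-split t (m ∸ t) f ⟩
    sumBelow t f + sumBelow (m ∸ t) (λ i → f (t + i))       ≡⟨ cong (sumBelow t f +_) (sumBelow-zero (m ∸ t) (λ i _ → f≗0 i)) ⟩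
    sumBelow t f + 0                                        ≡⟨ +-identityʳ _ ⟩
    sumBelow t f                                            ∎
    where open ≡-Reasoning

  count-upTo : ∀ n (f : ℕ → Bool) → count f (upTo n) ≡ sumBelow n (λ i → if f i then 1 else 0)
  count-upTo zero    f = refl
  count-upTo (suc n) f = begin
    count f (upTo (suc n))          ≡⟨ cong (count f) (sym (upTo-∷ʳ n)) ⟩
    count f (upTo n ++ [ n ])       ≡⟨ count-++ f (upTo n) [ n ] ⟩
    count f (upTo n) + count f [ n ] ≡⟨ cong₂ _+_ (count-upTo n f) (+-identityʳ _) ⟩
    sumBelow (suc n) (λ i → if f i then 1 else 0) ∎
    where open ≡-Reasoning

  count-byFirstLetter : ∀ (g : Word → Bool) m L →
    count g (allWords m (suc L)) ≡ sumBelow m (λ x → count (λ w → g (x ∷ w)) (allWords m L))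
  count-byFirstLetter g m L = go (allWords m L)
    where
    go : ∀ ws → count g (concatMap (λ w → map (_∷ w) (upTo m)) ws) ≡ sumBelow m (λ x → count (λ w → g (x ∷ w)) ws)
    go []       = sym (sumBelow-zero m (λ _ _ → refl))
    go (w ∷ ws) = begin
      count g (map (_∷ w) (upTo m) ++ concatMap (λ w → map (_∷ w) (upTo m)) ws)
        ≡⟨ count-++ g (map (_∷ w) (upTo m)) _ ⟩
      count g (map (_∷ w) (upTo m)) + count g (concatMap (λ w → map (_∷ w) (upTo m)) ws)
        ≡⟨ cong₂ _+_ (trans (count-map (upTo m)) (count-upTo m (λ x → g (x ∷ w)))) (go ws) ⟩
      sumBelow m (λ x → if g (x ∷ w) then 1 else 0) + sumBelow m (λ x → count (λ w → g (x ∷ w)) ws)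
        ≡⟨ sym (sumBelow-+ m _ _) ⟩
      sumBelow m (λ x → count (λ w → g (x ∷ w)) (w ∷ ws)) ∎
      where
      open ≡-Reasoning
      count-map : ∀ xs → count g (map (_∷ w) xs) ≡ count (λ x → g (x ∷ w)) xs
      count-map []       = refl
      count-map (x ∷ xs) = cong ((if g (x ∷ w) then 1 else 0) +_) (count-map xs)

module Automata where

  open Counting
  open import Data.Bool using (Bool; true; false; _∧_; if_then_else_)
  open import Data.Bool.Properties using (∧-zeroʳ; ∧-assoc)
  open import Data.List using (List; []; _∷_)
  open import Data.Maybe using (Maybe; just; nothing; maybe′)
  open import Data.Nat using (ℕ; zero; suc; _+_; _≤_; _<_; z≤n; s≤s; _<ᵇ_; _≡ᵇ_)
  open import Data.Nat.Properties using (+-identityʳ; +-suc; ≤-trans; ≤-refl; ≤-reflexive; m≤m+n; +-monoˡ-≤)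
  open import Relation.Binary.PropositionalEquality using (_≡_; refl; sym; trans; cong; cong₂; module ≡-Reasoning)

  data Position : Set where
    farBelow justBelow same justAbove farAbove : Position

  position : ℕ → ℕ → Position
  position x       zero    = above x
    where
    above : ℕ → Position
    above zero          = same
    above (suc zero)    = justAbove
    above (suc (suc _)) = farAbove
  position zero    (suc p) = below p
    where
    below : ℕ → Position
    below zero    = justBelow
    below (suc _) = farBelow
  position (suc x) (suc p) = position x p

  data PositionSpec : ℕ → ℕ → Position → Set where
    farBelow  : ∀ {x p} → suc x < p → PositionSpec x p farBelow
    justBelow : ∀ {x} → PositionSpec x (suc x) justBelow
    same      : ∀ {x} → PositionSpec x x same
    justAbove : ∀ {p} → PositionSpec (suc p) p justAbove
    farAbove  : ∀ {x p} → suc p < x → PositionSpec x p farAbove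

  position-spec : ∀ x p → PositionSpec x p (position x p)
  position-spec zero          zero          = same
  position-spec zero          (suc zero)    = justBelow
  position-spec zero          (suc (suc _)) = farBelow (s≤s (s≤s z≤n))
  position-spec (suc zero)    zero          = justAbove
  position-spec (suc (suc _)) zero          = farAbove (s≤s (s≤s z≤n))
  position-spec (suc x)       (suc p)       = shift (position-spec x p)
    where
    shift : ∀ {x p r} → PositionSpec x p r → PositionSpec (suc x) (suc p) r
    shift (farBelow lt) = farBelow (s≤s lt)
    shift justBelow     = justBelow
    shift same          = same
    shift justAbove     = justAbove
    shift (farAbove lt) = farAbove (s≤s lt)

  isBelow : Position → Bool
  isBelow farBelow  = true
  isBelow justBelow = true
  isBelow _         = false

  isBelow-position : ∀ x p → isBelow (position x p) ≡ (x <ᵇ p)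
  isBelow-position zero          zero          = refl
  isBelow-position zero          (suc zero)    = refl
  isBelow-position zero          (suc (suc _)) = refl
  isBelow-position (suc zero)    zero          = refl
  isBelow-position (suc (suc _)) zero          = refl
  isBelow-position (suc x)       (suc p)       = isBelow-position x p

  position-farAbove : ∀ {x p} → suc p < x → position x p ≡ farAbove
  position-farAbove {suc (suc _)} {zero}  _        = refl
  position-farAbove {suc x}       {suc p} (s≤s lt) = position-farAbove lt

  position-same : ∀ x → position x x ≡ same
  position-same zero    = refl
  position-same (suc x) = position-same x

  position-justAbove : ∀ p → position (suc p) p ≡ justAbove
  position-justAbove zero    = refl
  position-justAbove (suc p) = position-justAbove p

  position-justBelow : ∀ x → position x (suc x) ≡ justBelow
  position-justBelow zero    = refl
  position-justBelow (suc x) = position-justBelow x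

  position-farBelow : ∀ {x p} → suc x < p → position x p ≡ farBelow
  position-farBelow {zero}  {suc zero}    (s≤s ())
  position-farBelow {zero}  {suc (suc _)} _        = refl
  position-farBelow {suc x} {suc p}       (s≤s lt) = position-farBelow lt

  descend : {A : Set} → A → (ℕ → A) → ℕ → A
  descend z f zero    = z
  descend z f (suc k) = f k

  descentIf : {A : Set} → Bool → A → (ℕ → A) → ℕ → A
  descentIf true  z f = descend z f
  descentIf false z f = f

  descentIf-cong : {A : Set} (b : Bool) {z : A} {f g : ℕ → A} → (∀ k → f k ≡ g k) → ∀ k →
                   descentIf b z f k ≡ descentIf b z g k
  descentIf-cong false f≗g k       = f≗g k
  descentIf-cong true  f≗g zero    = refl
  descentIf-cong true  f≗g (suc k) = f≗g k

  count-descentIf : {A : Set} (b : Bool) (f : A → ℕ → Bool) (k : ℕ) (xs : List A) →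
    count (λ x → descentIf b false (f x) k) xs ≡ descentIf b 0 (λ k′ → count (λ x → f x k′) xs) k
  count-descentIf false f k       xs = refl
  count-descentIf true  f zero    xs = count-false (λ _ → refl) xs
  count-descentIf true  f (suc k) xs = refl

  sumBelow-descend : ∀ n (f : ℕ → ℕ → ℕ) k →
    sumBelow n (λ x → descend 0 (f x) k) ≡ descend 0 (λ k′ → sumBelow n (λ x → f x k′)) k
  sumBelow-descend n f zero    = sumBelow-zero n (λ _ _ → refl)
  sumBelow-descend n f (suc k) = refl

  module Run {State : Set} (step : State → Position → Maybe State) where

    runs : State → ℕ → Word → Bool
    runs s p []      = true
    runs s p (x ∷ w) = maybe′ (λ s′ → runs s′ x w) false (step s (position x p))

    runs-unique : (valid : State → ℕ → Word → Bool) → (∀ s p → valid s p [] ≡ true) →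
                  (∀ s p x w → valid s p (x ∷ w) ≡ maybe′ (λ s′ → valid s′ x w) false (step s (position x p))) →
                  ∀ s p w → runs s p w ≡ valid s p w
    runs-unique valid valid-[] valid-∷ s p []      = sym (valid-[] s p)
    runs-unique valid valid-[] valid-∷ s p (x ∷ w) with step s (position x p) | valid-∷ s p x w
    ... | nothing | eq = sym eq
    ... | just s′ | eq = trans (runs-unique valid valid-[] valid-∷ s′ x w) (sym eq)

    accepts : State → ℕ → Word → ℕ → Bool
    accepts s p []      k = k ≡ᵇ 0
    accepts s p (x ∷ w) k =
      maybe′ (λ s′ → descentIf (isBelow (position x p)) false (accepts s′ x w) k) false (step s (position x p))

    accepts≡runs∧descents : ∀ s p w k → accepts s p w k ≡ runs s p w ∧ (descents (p ∷ w) ≡ᵇ k)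
    accepts≡runs∧descents s p []      k = ≡ᵇ-sym k 0
      where
      ≡ᵇ-sym : ∀ m n → (m ≡ᵇ n) ≡ (n ≡ᵇ m)
      ≡ᵇ-sym zero    zero    = refl
      ≡ᵇ-sym zero    (suc n) = refl
      ≡ᵇ-sym (suc m) zero    = refl
      ≡ᵇ-sym (suc m) (suc n) = ≡ᵇ-sym m n
    accepts≡runs∧descents s p (x ∷ w) k rewrite sym (isBelow-position x p)
      with step s (position x p) | isBelow (position x p)
    ... | nothing | _     = refl
    ... | just s′ | false = accepts≡runs∧descents s′ x w k
    ... | just s′ | true with k
    ...   | zero  = sym (∧-zeroʳ (runs s′ x w))
    ...   | suc k = accepts≡runs∧descents s′ x w k

    mutual
      tally : State → ℕ → ℕ → ℕ → ℕ
      tally s p zero    k = if k ≡ᵇ 0 then 1 else 0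
      tally s p (suc L) k = sumBelow (suc (suc p)) (tallyVia s p L k)

      tallyVia : State → ℕ → ℕ → ℕ → ℕ → ℕ
      tallyVia s p L k x =
        maybe′ (λ s′ → descentIf (isBelow (position x p)) 0 (tally s′ x L) k) 0 (step s (position x p))

    module _ (rejects-farAbove : ∀ s → step s farAbove ≡ nothing) where

      count-accepts : ∀ L s p k {m} → suc p + L ≤ m → count (λ w → accepts s p w k) (allWords m L) ≡ tally s p L k
      count-accepts zero    s p k _ = +-identityʳ _
      count-accepts (suc L) s p k {m} bound = begin
        count (λ w → accepts s p w k) (allWords m (suc L))
          ≡⟨ count-byFirstLetter (λ w → accepts s p w k) m L ⟩
        sumBelow m (λ x → count (λ w → accepts s p (x ∷ w) k) (allWords m L))
          ≡⟨ sumBelow-vanishing _ (≤-trans (m≤m+n (suc (suc p)) L) (shorter ≤-refl))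
                                (λ i → count-false (beyond i) (allWords m L)) ⟩
        sumBelow (suc (suc p)) (λ x → count (λ w → accepts s p (x ∷ w) k) (allWords m L))
          ≡⟨ sumBelow-cong< (suc (suc p)) by-letter ⟩
        tally s p (suc L) k ∎
        where
        open ≡-Reasoning
        beyond : ∀ i w → accepts s p (suc (suc p) + i ∷ w) k ≡ false
        beyond i w rewrite position-farAbove {suc (suc p) + i} {p} (s≤s (s≤s (m≤m+n p i))) | rejects-farAbove s = refl
        shorter : ∀ {x} → x < suc (suc p) → suc x + L ≤ m
        shorter x≤p+1 = ≤-trans (+-monoˡ-≤ L x≤p+1) (≤-trans (≤-reflexive (sym (+-suc (suc p) L))) bound)
        by-letter : ∀ x → x < suc (suc p) → count (λ w → accepts s p (x ∷ w) k) (allWords m L) ≡ tallyVia s p L k x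
        by-letter x x≤p+1 with step s (position x p)
        ... | nothing = count-false (λ _ → refl) (allWords m L)
        ... | just s′ = trans (count-descentIf (isBelow (position x p)) (λ w → accepts s′ x w) k (allWords m L))
                              (descentIf-cong (isBelow (position x p)) (λ k′ → count-accepts L s′ x k′ (shorter x≤p+1)) k)

      cnk≡tally : ∀ pat s₀ → (∀ w → catStep 0 w ∧ avoids pat (0 ∷ w) ≡ runs s₀ 0 w) →
                  ∀ L k → cnk pat (suc L) k ≡ tally s₀ 0 L k
      cnk≡tally pat s₀ characterisation L k = begin
        cnk pat (suc L) k
          ≡⟨ countᵇ≡count P (filterᵇ isCatalan (allWords (suc L) (suc L))) ⟩
        count P (filterᵇ isCatalan (allWords (suc L) (suc L)))
          ≡⟨ count-filterᵇ isCatalan P (allWords (suc L) (suc L)) ⟩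
        count (λ w → isCatalan w ∧ P w) (allWords (suc L) (suc L))
          ≡⟨ count-byFirstLetter (λ w → isCatalan w ∧ P w) (suc L) L ⟩
        sumBelow (suc L) (λ x → count (λ w → isCatalan (x ∷ w) ∧ P (x ∷ w)) (allWords (suc L) L))
          ≡⟨ sumBelow-vanishing {1} {suc L} (λ x → count (λ w → isCatalan (x ∷ w) ∧ P (x ∷ w)) (allWords (suc L) L))
               (s≤s z≤n) (λ i → count-false (λ w → refl) (allWords (suc L) L)) ⟩
        count (λ w → catStep 0 w ∧ P (0 ∷ w)) (allWords (suc L) L)
          ≡⟨ count-cong starts-with-0 (allWords (suc L) L) ⟩
        count (λ w → accepts s₀ 0 w k) (allWords (suc L) L)
          ≡⟨ count-accepts L s₀ 0 k ≤-refl ⟩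
        tally s₀ 0 L k ∎
        where
        open ≡-Reasoning
        P : Word → Bool
        P w = avoids pat w ∧ (descents w ≡ᵇ k)
        starts-with-0 : ∀ w → catStep 0 w ∧ P (0 ∷ w) ≡ accepts s₀ 0 w k
        starts-with-0 w = begin
          catStep 0 w ∧ (avoids pat (0 ∷ w) ∧ (descents (0 ∷ w) ≡ᵇ k))
            ≡⟨ sym (∧-assoc (catStep 0 w) _ _) ⟩
          (catStep 0 w ∧ avoids pat (0 ∷ w)) ∧ (descents (0 ∷ w) ≡ᵇ k)
            ≡⟨ cong (_∧ (descents (0 ∷ w) ≡ᵇ k)) (characterisation w) ⟩
          runs s₀ 0 w ∧ (descents (0 ∷ w) ≡ᵇ k)
            ≡⟨ sym (accepts≡runs∧descents s₀ 0 w k) ⟩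
          accepts s₀ 0 w k ∎

    tallyVia-same : ∀ {s s′} p L k → step s same ≡ just s′ → tallyVia s p L k p ≡ tally s′ p L k
    tallyVia-same p L k eq rewrite position-same p | eq = refl

    tallyVia-justAbove : ∀ {s s′} p L k → step s justAbove ≡ just s′ → tallyVia s p L k (suc p) ≡ tally s′ (suc p) L k
    tallyVia-justAbove p L k eq rewrite position-justAbove p | eq = refl

    tallyVia-rejected : ∀ {s} p L k → step s justAbove ≡ nothing → tallyVia s p L k (suc p) ≡ 0
    tallyVia-rejected p L k eq rewrite position-justAbove p | eq = refl

    tallyVia-justBelow : ∀ {s s′} x L k → step s justBelow ≡ just s′ →
                         tallyVia s (suc x) L k x ≡ descend 0 (tally s′ x L) k
    tallyVia-justBelow x L k eq rewrite position-justBelow x | eq = refl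

    sum-tallyVia-farBelow : ∀ {s s′} p L k → step s farBelow ≡ just s′ →
      sumBelow p (tallyVia s (suc p) L k) ≡ descend 0 (λ k′ → sumBelow p (λ x → tally s′ x L k′)) k
    sum-tallyVia-farBelow {s} {s′} p L k eq =
      trans (sumBelow-cong< p far) (sumBelow-descend p (λ x → tally s′ x L) k)
      where
      far : ∀ x → x < p → tallyVia s (suc p) L k x ≡ descend 0 (tally s′ x L) k
      far x x<p rewrite position-farBelow {x} {suc p} (s≤s x<p) | eq = refl

    sum-tallyVia-below : ∀ {s s′} p L k → step s farBelow ≡ just s′ → step s justBelow ≡ just s′ →
      sumBelow p (tallyVia s p L k) ≡ descend 0 (λ k′ → sumBelow p (λ x → tally s′ x L k′)) k
    sum-tallyVia-below {s} {s′} zero    L k _          _            = sumBelow-descend 0 (λ x → tally s′ x L) k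
    sum-tallyVia-below {s} {s′} (suc p) L k farBelow≡ justBelow≡ =
      trans (cong₂ _+_ (sum-tallyVia-farBelow p L k farBelow≡) (tallyVia-justBelow p L k justBelow≡))
            (sym (descend-+ k))
      where
      descend-+ : ∀ k → descend 0 (λ k′ → sumBelow p (λ x → tally s′ x L k′) + tally s′ p L k′) k
                      ≡ descend 0 (λ k′ → sumBelow p (λ x → tally s′ x L k′)) k + descend 0 (tally s′ p L) k
      descend-+ zero    = refl
      descend-+ (suc k) = refl

module BooleanOrder where

  open import Data.Bool using (true; false)
  open import Data.Nat using (zero; suc; _≤_; _<_; z≤n; s≤s; _<ᵇ_; _≤ᵇ_)
  open import Relation.Binary.PropositionalEquality using (_≡_; refl)

  <ᵇ-true : ∀ {m n} → m < n → (m <ᵇ n) ≡ true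
  <ᵇ-true {zero}  {suc n} _       = refl
  <ᵇ-true {suc m} {suc n} (s≤s p) = <ᵇ-true p

  <ᵇ-false : ∀ {m n} → n ≤ m → (m <ᵇ n) ≡ false
  <ᵇ-false {m}     {zero}  _       = refl
  <ᵇ-false {suc m} {suc n} (s≤s p) = <ᵇ-false p

  ≤ᵇ-true : ∀ {m n} → m ≤ n → (m ≤ᵇ n) ≡ true
  ≤ᵇ-true {zero}  _ = refl
  ≤ᵇ-true {suc m} p = <ᵇ-true p

  ≤ᵇ-false : ∀ {m n} → n < m → (m ≤ᵇ n) ≡ false
  ≤ᵇ-false {suc m} (s≤s p) = <ᵇ-false p

  <ᵇ≡true⇒< : ∀ {m n} → (m <ᵇ n) ≡ true → m < n
  <ᵇ≡true⇒< {zero}  {suc n} _ = s≤s z≤n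
  <ᵇ≡true⇒< {suc m} {suc n} e = s≤s (<ᵇ≡true⇒< e)

  <ᵇ≡false⇒≥ : ∀ {m n} → (m <ᵇ n) ≡ false → n ≤ m
  <ᵇ≡false⇒≥ {m}     {zero}  _ = z≤n
  <ᵇ≡false⇒≥ {suc m} {suc n} e = s≤s (<ᵇ≡false⇒≥ e)

  ≤ᵇ≡true⇒≤ : ∀ {m n} → (m ≤ᵇ n) ≡ true → m ≤ n
  ≤ᵇ≡true⇒≤ {zero}  _ = z≤n
  ≤ᵇ≡true⇒≤ {suc m} e = <ᵇ≡true⇒< e

  ≤ᵇ≡false⇒> : ∀ {m n} → (m ≤ᵇ n) ≡ false → n < m
  ≤ᵇ≡false⇒> {suc m} e = s≤s (<ᵇ≡false⇒≥ e)

  <ᵇ-trans : ∀ a b c → (a <ᵇ b) ≡ true → (b <ᵇ c) ≡ true → (a <ᵇ c) ≡ true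
  <ᵇ-trans zero    (suc b) (suc c) _ _ = refl
  <ᵇ-trans (suc a) (suc b) (suc c) p q = <ᵇ-trans a b c p q

module LengthThreePatterns where

  open BooleanOrder using (<ᵇ-trans)
  open import Data.Bool using (Bool; true; false; _∧_; _∨_)
  open import Data.Bool.Properties using (∧-identityʳ; ∧-zeroʳ)
  open import Data.Bool.ListAction using (any)
  open import Data.List using (List; []; _∷_; _++_; map)
  open import Data.Nat using (ℕ; zero; suc; _<ᵇ_)
  open import Relation.Binary.PropositionalEquality using (_≡_; refl; cong; cong₂; trans)

  -- agree i j a b only depends on whether i < j, so these two lemmas cover every pair of letters of p102 and p201.
  agree-ascending : ∀ a b → agree 0 1 a b ≡ (a <ᵇ b)
  agree-ascending zero    zero    = refl
  agree-ascending zero    (suc b) = refl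
  agree-ascending (suc a) zero    = refl
  agree-ascending (suc a) (suc b) = agree-ascending a b

  agree-descending : ∀ a b → agree 1 0 a b ≡ (b <ᵇ a)
  agree-descending zero    zero    = refl
  agree-descending zero    (suc b) = refl
  agree-descending (suc a) zero    = refl
  agree-descending (suc a) (suc b) = agree-descending a b

  orderIso-102 : ∀ x y z → orderIso p102 (x ∷ y ∷ z ∷ []) ≡ (y <ᵇ x) ∧ (x <ᵇ z)
  orderIso-102 x y z
    rewrite agree-descending x y | agree-ascending x z | agree-ascending y z
          | ∧-identityʳ (x <ᵇ z) | ∧-identityʳ (y <ᵇ z) | ∧-identityʳ (y <ᵇ z)
    with y <ᵇ x in yx | x <ᵇ z in xz
  ... | true  | true  rewrite <ᵇ-trans y x z yx xz = refl
  ... | true  | false = refl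
  ... | false | _     = refl

  orderIso-201 : ∀ x y z → orderIso p201 (x ∷ y ∷ z ∷ []) ≡ (z <ᵇ x) ∧ (y <ᵇ z)
  orderIso-201 x y z
    rewrite agree-descending x y | agree-descending x z | agree-ascending y z
          | ∧-identityʳ (z <ᵇ x) | ∧-identityʳ (y <ᵇ z) | ∧-identityʳ (y <ᵇ z)
    with z <ᵇ x in zx | y <ᵇ z in yz
  ... | true  | true  rewrite <ᵇ-trans y z x yz zx = refl
  ... | true  | false = ∧-zeroʳ _
  ... | false | _     rewrite ∧-zeroʳ (y <ᵇ x) = refl

  any-++ : {A : Set} (f : A → Bool) (xs ys : List A) → any f (xs ++ ys) ≡ any f xs ∨ any f ys
  any-++ f []       ys = refl
  any-++ f (x ∷ xs) ys with f x
  ... | true  = refl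
  ... | false = any-++ f xs ys

  any-map : {A B : Set} (f : B → Bool) (g : A → B) (xs : List A) → any f (map g xs) ≡ any (λ x → f (g x)) xs
  any-map f g []       = refl
  any-map f g (x ∷ xs) = cong (f (g x) ∨_) (any-map f g xs)

  any-cong : {A : Set} {f g : A → Bool} → (∀ x → f x ≡ g x) → (xs : List A) → any f xs ≡ any g xs
  any-cong f≗g []       = refl
  any-cong f≗g (x ∷ xs) = cong₂ _∨_ (f≗g x) (any-cong f≗g xs)

  any-pairs-∷ : (f : Word → Bool) (y : ℕ) (w : Word) →
    any f (subseqs 2 (y ∷ w)) ≡ any (λ z → f (y ∷ z ∷ [])) w ∨ any f (subseqs 2 w)
  any-pairs-∷ f y w = trans (any-++ f (map (y ∷_) (subseqs 1 w)) (subseqs 2 w))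
    (cong (_∨ any f (subseqs 2 w)) (trans (any-map f (y ∷_) (subseqs 1 w)) (singletons w)))
    where
    singletons : ∀ w → any (λ s → f (y ∷ s)) (subseqs 1 w) ≡ any (λ z → f (y ∷ z ∷ [])) w
    singletons []      = refl
    singletons (z ∷ w) = cong (f (y ∷ z ∷ []) ∨_) (singletons w)

  contains-∷ : (a b c x : ℕ) (w : Word) → let p = a ∷ b ∷ c ∷ [] in
    contains p (x ∷ w) ≡ any (λ s → orderIso p (x ∷ s)) (subseqs 2 w) ∨ contains p w
  contains-∷ a b c x w = trans (any-++ _ (map (x ∷_) (subseqs 2 w)) (subseqs 3 w))
    (cong (_∨ contains (a ∷ b ∷ c ∷ []) w) (any-map _ (x ∷_) (subseqs 2 w)))

module Avoiding102 where

  open Counting using (sumBelow)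
  open Automata
  open BooleanOrder
  open LengthThreePatterns
  open import Data.Bool using (Bool; true; false; _∧_; _∨_; not)
  open import Data.Bool.Properties using (∧-zeroʳ; ∧-identityʳ; ∨-zeroʳ; ∨-identityʳ; ∨-conicalˡ; ∨-conicalʳ; ∨-assoc; ∨-comm)
  open import Data.Bool.ListAction using (any)
  open import Data.List using ([]; _∷_)
  open import Data.Maybe using (Maybe; just; nothing; maybe′)
  open import Data.Nat using (ℕ; suc; _+_; _≤_; _<_; s≤s; _<ᵇ_)
  open import Data.Nat.Properties
    using (+-identityʳ; ≤-refl; ≤-trans; <-trans; <⇒≤; n≤1+n; n<1+n; ≤-<-trans; m<n⇒m<1+n; ≤-antisym; ≤-pred)
  open import Relation.Binary.PropositionalEquality using (_≡_; refl; sym; trans; cong; cong₂)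

  anyAbove : ℕ → Word → Bool
  anyAbove t = any (t <ᵇ_)

  completes102 : ℕ → Word → Bool
  completes102 x []      = false
  completes102 x (y ∷ w) = ((y <ᵇ x) ∧ anyAbove x w) ∨ completes102 x w

  contains102 : Word → Bool
  contains102 []      = false
  contains102 (x ∷ w) = completes102 x w ∨ contains102 w

  -- An occurrence of 102 whose 1 is taken from a prefix that contains every letter 0, …, v.
  completes102Below : ℕ → Word → Bool
  completes102Below v []      = false
  completes102Below v (y ∷ w) = ((y <ᵇ v) ∧ anyAbove (suc y) w) ∨ completes102Below v w

  risesByTwo : Word → Bool
  risesByTwo []      = false
  risesByTwo (y ∷ w) = anyAbove (suc y) w ∨ risesByTwo w

  contains-p102 : ∀ w → contains p102 w ≡ contains102 w
  contains-p102 []      = refl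
  contains-p102 (x ∷ w) =
    trans (contains-∷ 1 0 2 x w) (cong₂ _∨_ (completes x w) (contains-p102 w))
    where
    completes : ∀ x w → any (λ s → orderIso p102 (x ∷ s)) (subseqs 2 w) ≡ completes102 x w
    completes x []      = refl
    completes x (y ∷ w) = trans (any-pairs-∷ (λ s → orderIso p102 (x ∷ s)) y w)
      (cong₂ _∨_ (trans (any-cong (orderIso-102 x y) w) (factor (y <ᵇ x))) (completes x w))
      where
      factor : ∀ b → any (λ z → b ∧ (x <ᵇ z)) w ≡ b ∧ anyAbove x w
      factor true  = refl
      factor false = any-false w
        where
        any-false : ∀ w → any (λ _ → false) w ≡ false
        any-false []      = refl
        any-false (_ ∷ w) = any-false w

  anyAbove-antitone : ∀ {s t} w → s ≤ t → anyAbove t w ≡ true → anyAbove s w ≡ true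
  anyAbove-antitone {s} {t} (z ∷ w) s≤t above with t <ᵇ z in tz
  ... | true  rewrite <ᵇ-true {s} {z} (≤-<-trans s≤t (<ᵇ≡true⇒< tz)) = refl
  ... | false rewrite anyAbove-antitone w s≤t above = ∨-zeroʳ (s <ᵇ z)

  anyAbove-antitone′ : ∀ {s t} w → s ≤ t → anyAbove s w ≡ false → anyAbove t w ≡ false
  anyAbove-antitone′ {s} {t} w s≤t none with anyAbove t w in above
  ... | false = refl
  ... | true  = trans (sym (anyAbove-antitone w s≤t above)) none

  completes102Below≡risesByTwo : ∀ {x v} w → x < v → anyAbove (suc x) w ≡ false →
                                 completes102Below v w ≡ risesByTwo w
  completes102Below≡risesByTwo []      x<v none = refl
  completes102Below≡risesByTwo {x} {v} (y ∷ w) x<v none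
    rewrite completes102Below≡risesByTwo w x<v (∨-conicalʳ _ _ none) with y <ᵇ v in yv
  ... | true  = refl
  ... | false rewrite anyAbove-antitone′ {suc x} {suc y} w (s≤s (<⇒≤ (≤-trans x<v (<ᵇ≡false⇒≥ yv)))) (∨-conicalʳ _ _ none) = refl

  catStep-steady : ∀ x w → anyAbove (suc x) w ≡ false → risesByTwo w ≡ false → catStep x w ≡ true
  catStep-steady x []      _    _     = refl
  catStep-steady x (y ∷ w) none calm
    rewrite ≤ᵇ-true {y} {suc x} (<ᵇ≡false⇒≥ (∨-conicalˡ _ _ none))
    = catStep-steady y w (∨-conicalˡ _ _ calm) (∨-conicalʳ _ _ calm)

  completes102-steady : ∀ x w → risesByTwo w ≡ false → completes102 x w ≡ false
  completes102-steady x []      _    = refl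
  completes102-steady x (y ∷ w) calm rewrite completes102-steady x w (∨-conicalʳ _ _ calm) with y <ᵇ x in yx
  ... | false = refl
  ... | true  rewrite anyAbove-antitone′ {suc y} {x} w (<ᵇ≡true⇒< yx) (∨-conicalˡ _ _ calm) = refl

  contains102-steady : ∀ w → risesByTwo w ≡ false → contains102 w ≡ false
  contains102-steady []      _    = refl
  contains102-steady (y ∷ w) calm
    rewrite completes102-steady y w (∨-conicalʳ _ _ calm) | contains102-steady w (∨-conicalʳ _ _ calm) = refl

  completes102⇒completes102Below : ∀ v w → completes102 v w ≡ true → completes102Below v w ≡ true
  completes102⇒completes102Below v (y ∷ w) h with completes102 v w in rest
  ... | true  rewrite completes102⇒completes102Below v w rest = ∨-zeroʳ _
  ... | false with y <ᵇ v in yv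
  ...   | true  rewrite anyAbove-antitone {suc y} {v} w (<ᵇ≡true⇒< yv) (trans (sym (∨-identityʳ _)) h) = refl
  ...   | false with trans (sym (∨-identityʳ _)) h
  ...     | ()

  ∨-insert-implied : ∀ a p b c → (c ≡ true → a ≡ true) → a ∨ (p ∨ b) ≡ (a ∨ p) ∨ (c ∨ b)
  ∨-insert-implied true  p b c     _   = refl
  ∨-insert-implied false p b false _   = refl
  ∨-insert-implied false p b true  c⇒a with c⇒a refl
  ... | ()

  ∨-exchange : ∀ a p b → a ∨ (p ∨ b) ≡ p ∨ (a ∨ b)
  ∨-exchange a p b = trans (sym (∨-assoc a p b)) (trans (cong (_∨ b) (∨-comm a p)) (∨-assoc p a b))

  completes102Below-suc : ∀ v w → completes102Below (suc v) w ≡ completes102Below v w ∨ completes102 (suc v) w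
  completes102Below-suc v []      = refl
  completes102Below-suc v (y ∷ w) rewrite completes102Below-suc v w
    with y <ᵇ v in yv | y <ᵇ suc v in ysv
  ... | true  | true  =
    ∨-insert-implied (anyAbove (suc y) w) _ _ _ (anyAbove-antitone {suc y} {suc v} w (s≤s (<⇒≤ (<ᵇ≡true⇒< yv))))
  ... | false | true  rewrite ≤-antisym {y} {v} (≤-pred (<ᵇ≡true⇒< ysv)) (<ᵇ≡false⇒≥ yv) =
    ∨-exchange (anyAbove (suc v) w) (completes102Below v w) (completes102 (suc v) w)
  ... | false | false = refl
  ... | true  | false with trans (sym (<ᵇ-true {y} {suc v} (m<n⇒m<1+n (<ᵇ≡true⇒< yv)))) ysv
  ...   | ()

  -- ascending: no descent yet, so the word so far is 0…0 1…1 … p…p.  After a descent every later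
  -- letter exceeds the previous letters of the tail by at most one: in state low the previous
  -- letter p may still be followed by p + 1, in state high it is the largest value allowed.
  data State102 : Set where
    ascending low high : State102

  step102 : State102 → Position → Maybe State102
  step102 ascending farBelow  = just low
  step102 ascending justBelow = just low
  step102 ascending same      = just ascending
  step102 ascending justAbove = just ascending
  step102 low       farBelow  = just low
  step102 low       justBelow = just low
  step102 low       same      = just low
  step102 low       justAbove = just high
  step102 high      farBelow  = just low
  step102 high      justBelow = just low
  step102 high      same      = just high
  step102 _         _         = nothing

  valid102 : State102 → ℕ → Word → Bool
  valid102 ascending p w = catStep p w ∧ (not (contains102 w) ∧ not (completes102Below p w))
  valid102 low       p w = not (anyAbove (suc p) w) ∧ not (risesByTwo w)
  valid102 high      p w = not (anyAbove p w) ∧ not (risesByTwo w)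

  not∧not∨-implied : ∀ a b r → (a ≡ true → b ≡ true) → not a ∧ not (b ∨ r) ≡ not b ∧ not r
  not∧not∨-implied true  true  r _   = refl
  not∧not∨-implied false true  r _   = refl
  not∧not∨-implied false false r _   = refl
  not∧not∨-implied true  false r a⇒b with a⇒b refl
  ... | ()

  not∧not∨-implies : ∀ a b r → (b ≡ true → a ≡ true) → not a ∧ not (b ∨ r) ≡ not a ∧ not r
  not∧not∨-implies true  b     r _   = refl
  not∧not∨-implies false false r _   = refl
  not∧not∨-implies false true  r b⇒a with b⇒a refl
  ... | ()

  low-below : ∀ {x p} w → x < p → valid102 low p (x ∷ w) ≡ valid102 low x w
  low-below {x} {p} w x<p rewrite <ᵇ-false {suc p} {x} (<⇒≤ (m<n⇒m<1+n x<p)) =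
    not∧not∨-implied (anyAbove (suc p) w) (anyAbove (suc x) w) (risesByTwo w) (anyAbove-antitone w (s≤s (<⇒≤ x<p)))

  low-same : ∀ p w → valid102 low p (p ∷ w) ≡ valid102 low p w
  low-same p w rewrite <ᵇ-false {suc p} {p} (n≤1+n p) =
    not∧not∨-implied (anyAbove (suc p) w) (anyAbove (suc p) w) (risesByTwo w) (λ a → a)

  low-up : ∀ p w → valid102 low p (suc p ∷ w) ≡ valid102 high (suc p) w
  low-up p w rewrite <ᵇ-false {suc p} {suc p} ≤-refl =
    not∧not∨-implies (anyAbove (suc p) w) (anyAbove (suc (suc p)) w) (risesByTwo w) (anyAbove-antitone w (n≤1+n (suc p)))

  low-far : ∀ {x p} w → suc p < x → valid102 low p (x ∷ w) ≡ false
  low-far {x} {p} w p+1<x rewrite <ᵇ-true {suc p} {x} p+1<x = refl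

  high-below : ∀ {x p} w → x < p → valid102 high p (x ∷ w) ≡ valid102 low x w
  high-below {x} {p} w x<p rewrite <ᵇ-false {p} {x} (<⇒≤ x<p) =
    not∧not∨-implied (anyAbove p w) (anyAbove (suc x) w) (risesByTwo w) (anyAbove-antitone w x<p)

  high-same : ∀ p w → valid102 high p (p ∷ w) ≡ valid102 high p w
  high-same p w rewrite <ᵇ-false {p} {p} ≤-refl =
    not∧not∨-implies (anyAbove p w) (anyAbove (suc p) w) (risesByTwo w) (anyAbove-antitone w (n≤1+n p))

  high-above : ∀ {x p} w → p < x → valid102 high p (x ∷ w) ≡ false
  high-above {x} {p} w p<x rewrite <ᵇ-true {p} {x} p<x = refl

  ascending-below : ∀ {x v} w → x < v → valid102 ascending v (x ∷ w) ≡ valid102 low x w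
  ascending-below {x} {v} w x<v
    rewrite ≤ᵇ-true {x} {suc v} (<⇒≤ (m<n⇒m<1+n x<v)) | <ᵇ-true {x} {v} x<v
    with anyAbove (suc x) w in above
  ... | true  rewrite ∧-zeroʳ (not (completes102 x w ∨ contains102 w)) = ∧-zeroʳ (catStep x w)
  ... | false rewrite completes102Below≡risesByTwo w x<v above with risesByTwo w in rises
  ...   | true  rewrite ∧-zeroʳ (not (completes102 x w ∨ contains102 w)) = ∧-zeroʳ (catStep x w)
  ...   | false rewrite catStep-steady x w above rises | completes102-steady x w rises | contains102-steady w rises = refl

  ascending-same : ∀ v w → valid102 ascending v (v ∷ w) ≡ valid102 ascending v w
  ascending-same v w rewrite ≤ᵇ-true {v} {suc v} (n≤1+n v) | <ᵇ-false {v} {v} ≤-refl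
    with completes102 v w in completes
  ... | false = refl
  ... | true  rewrite completes102⇒completes102Below v w completes | ∧-zeroʳ (not (contains102 w)) = refl

  ascending-up : ∀ v w → valid102 ascending v (suc v ∷ w) ≡ valid102 ascending (suc v) w
  ascending-up v w rewrite <ᵇ-true {v} {suc v} (n<1+n v) | <ᵇ-false {suc v} {v} (n≤1+n v) | completes102Below-suc v w =
    move (catStep (suc v) w) (completes102 (suc v) w) (contains102 w) (completes102Below v w)
    where
    move : ∀ c b n p → c ∧ (not (b ∨ n) ∧ not p) ≡ c ∧ (not n ∧ not (p ∨ b))
    move c true  true  true  = refl
    move c true  true  false = refl
    move c true  false true  = refl
    move c true  false false = refl
    move c false n     p     rewrite ∨-identityʳ p = refl

  ascending-far : ∀ {x v} w → suc v < x → valid102 ascending v (x ∷ w) ≡ false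
  ascending-far {x} {v} w v+1<x rewrite ≤ᵇ-false {x} {suc v} v+1<x = refl

  valid102-∷ : ∀ s p x w → valid102 s p (x ∷ w) ≡ maybe′ (λ s′ → valid102 s′ x w) false (step102 s (position x p))
  valid102-∷ s p x w with position x p | position-spec x p
  valid102-∷ ascending p x w | farBelow  | farBelow lt = ascending-below w (<-trans (n<1+n x) lt)
  valid102-∷ ascending _ x w | justBelow | justBelow   = ascending-below w (n<1+n x)
  valid102-∷ ascending _ x w | same      | same        = ascending-same x w
  valid102-∷ ascending p _ w | justAbove | justAbove   = ascending-up p w
  valid102-∷ ascending p x w | farAbove  | farAbove lt = ascending-far w lt
  valid102-∷ low       p x w | farBelow  | farBelow lt = low-below w (<-trans (n<1+n x) lt)
  valid102-∷ low       _ x w | justBelow | justBelow   = low-below w (n<1+n x)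
  valid102-∷ low       _ x w | same      | same        = low-same x w
  valid102-∷ low       p _ w | justAbove | justAbove   = low-up p w
  valid102-∷ low       p x w | farAbove  | farAbove lt = low-far w lt
  valid102-∷ high      p x w | farBelow  | farBelow lt = high-below w (<-trans (n<1+n x) lt)
  valid102-∷ high      _ x w | justBelow | justBelow   = high-below w (n<1+n x)
  valid102-∷ high      _ x w | same      | same        = high-same x w
  valid102-∷ high      p _ w | justAbove | justAbove   = high-above w (n<1+n p)
  valid102-∷ high      p x w | farAbove  | farAbove lt = high-above w (<-trans (n<1+n p) lt)

  open Run step102 public

  step102-farAbove : ∀ s → step102 s farAbove ≡ nothing
  step102-farAbove ascending = refl
  step102-farAbove low       = refl
  step102-farAbove high      = refl

  runs102 : ∀ s p w → runs s p w ≡ valid102 s p w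
  runs102 = runs-unique valid102 (λ { ascending _ → refl ; low _ → refl ; high _ → refl }) valid102-∷

  completes102-0 : ∀ w → completes102 0 w ≡ false
  completes102-0 []      = refl
  completes102-0 (_ ∷ w) = completes102-0 w

  completes102Below-0 : ∀ w → completes102Below 0 w ≡ false
  completes102Below-0 []      = refl
  completes102Below-0 (_ ∷ w) = completes102Below-0 w

  characterisation102 : ∀ w → catStep 0 w ∧ avoids p102 (0 ∷ w) ≡ runs ascending 0 w
  characterisation102 w
    rewrite runs102 ascending 0 w | contains-p102 (0 ∷ w) | completes102-0 w | completes102Below-0 w
    = sym (cong (catStep 0 w ∧_) (∧-identityʳ (not (contains102 w))))

  cnk-p102 : ∀ L k → cnk p102 (suc L) k ≡ tally ascending 0 L k
  cnk-p102 = cnk≡tally step102-farAbove p102 ascending characterisation102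

  lowerTails : ℕ → ℕ → ℕ → ℕ
  lowerTails p L = descend 0 (λ k → sumBelow p (λ x → tally low x L k))

  tally-ascending : ∀ p L k → tally ascending p (suc L) k ≡ lowerTails p L k + tally ascending p L k + tally ascending (suc p) L k
  tally-ascending p L k =
    cong₂ _+_ (cong₂ _+_ (sum-tallyVia-below {ascending} p L k refl refl) (tallyVia-same {ascending} p L k refl))
              (tallyVia-justAbove {ascending} p L k refl)

  tally-low : ∀ p L k → tally low p (suc L) k ≡ lowerTails p L k + tally low p L k + tally high (suc p) L k
  tally-low p L k =
    cong₂ _+_ (cong₂ _+_ (sum-tallyVia-below {low} p L k refl refl) (tallyVia-same {low} p L k refl))
              (tallyVia-justAbove {low} p L k refl)

  tally-high : ∀ p L k → tally high p (suc L) k ≡ lowerTails p L k + tally high p L k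
  tally-high p L k =
    trans (cong₂ _+_ (cong₂ _+_ (sum-tallyVia-below {high} p L k refl refl) (tallyVia-same {high} p L k refl))
                     (tallyVia-rejected {high} p L k refl))
          (+-identityʳ _)

module Avoiding201 where

  open Counting using (sumBelow)
  open Automata
  open BooleanOrder
  open LengthThreePatterns
  open import Data.Bool using (Bool; true; false; _∧_; _∨_; not)
  open import Data.Bool.Properties using (∧-zeroʳ; ∧-identityʳ; ∨-zeroʳ; ∨-identityʳ)
  open import Data.Bool.ListAction using (any)
  open import Data.List using ([]; _∷_)
  open import Data.Maybe using (Maybe; just; nothing; maybe′)
  open import Data.Nat using (ℕ; suc; _+_; _≤_; _<_; z≤n; s≤s; _<ᵇ_; _≤ᵇ_)
  open import Data.Nat.Properties
    using (+-identityʳ; ≤-refl; ≤-trans; <-trans; <-irrefl; <⇒≤; n≤1+n; n<1+n; ≤-<-trans; m<n⇒m<1+n; ≤-antisym)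
  open import Relation.Binary.PropositionalEquality using (_≡_; refl; sym; trans; cong; cong₂)

  between : ℕ → ℕ → Word → Bool
  between y x = any (λ z → (z <ᵇ x) ∧ (y <ᵇ z))

  completes201 : ℕ → Word → Bool
  completes201 x []      = false
  completes201 x (y ∷ w) = between y x w ∨ completes201 x w

  contains201 : Word → Bool
  contains201 []      = false
  contains201 (x ∷ w) = completes201 x w ∨ contains201 w

  nonincreasing : ℕ → Word → Bool
  nonincreasing p []      = true
  nonincreasing p (x ∷ w) = (x ≤ᵇ p) ∧ nonincreasing x w

  contains-p201 : ∀ w → contains p201 w ≡ contains201 w
  contains-p201 []      = refl
  contains-p201 (x ∷ w) =
    trans (contains-∷ 2 0 1 x w) (cong₂ _∨_ (completes x w) (contains-p201 w))
    where
    completes : ∀ x w → any (λ s → orderIso p201 (x ∷ s)) (subseqs 2 w) ≡ completes201 x w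
    completes x []      = refl
    completes x (y ∷ w) = trans (any-pairs-∷ (λ s → orderIso p201 (x ∷ s)) y w)
      (cong₂ _∨_ (any-cong (orderIso-201 x y) w) (completes x w))

  between-adjacent : ∀ y x w → x ≤ suc y → between y x w ≡ false
  between-adjacent y x []      _      = refl
  between-adjacent y x (z ∷ w) x≤y+1 rewrite between-adjacent y x w x≤y+1 with z <ᵇ x in zx | y <ᵇ z in yz
  ... | false | _     = refl
  ... | true  | false = refl
  ... | true  | true with <-irrefl refl (≤-trans (<ᵇ≡true⇒< zx) (≤-trans x≤y+1 (<ᵇ≡true⇒< yz)))
  ...   | ()

  between-suc : ∀ y x w → between y x w ≡ true → between y (suc x) w ≡ true
  between-suc y x (z ∷ w) h with z <ᵇ x in zx | y <ᵇ z in yz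
  ... | true  | true  rewrite <ᵇ-true {z} {suc x} (m<n⇒m<1+n (<ᵇ≡true⇒< zx)) = refl
  ... | true  | false rewrite between-suc y x w h = ∨-zeroʳ _
  ... | false | _     rewrite between-suc y x w h = ∨-zeroʳ _

  completes201-suc : ∀ x w → completes201 x w ≡ true → completes201 (suc x) w ≡ true
  completes201-suc x (y ∷ w) h with between y x w in b
  ... | true  rewrite between-suc y x w b = refl
  ... | false rewrite completes201-suc x w h = ∨-zeroʳ _

  nonincreasing-between : ∀ y a b w → nonincreasing y w ≡ true → y ≤ a → between a b w ≡ false
  nonincreasing-between y a b []      _  _   = refl
  nonincreasing-between y a b (z ∷ w) ni y≤a with z ≤ᵇ y in zy
  ... | true rewrite nonincreasing-between z a b w ni (≤-trans (≤ᵇ≡true⇒≤ zy) y≤a)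
                   | <ᵇ-false {a} {z} (≤-trans (≤ᵇ≡true⇒≤ zy) y≤a) = trans (∨-identityʳ _) (∧-zeroʳ (z <ᵇ b))

  nonincreasing-completes201 : ∀ y t w → nonincreasing y w ≡ true → completes201 t w ≡ false
  nonincreasing-completes201 y t []      _  = refl
  nonincreasing-completes201 y t (z ∷ w) ni with z ≤ᵇ y
  ... | true rewrite nonincreasing-between z z t w ni ≤-refl | nonincreasing-completes201 z t w ni = refl

  weaken-false : ∀ c x a y b → c ∧ (not a ∧ not b) ≡ false → c ∧ (not (x ∨ a) ∧ not (y ∨ b)) ≡ false
  weaken-false false x a     y b    _  = refl
  weaken-false true  x true  y b    _  rewrite ∨-zeroʳ x = refl
  weaken-false true  x false y true _  rewrite ∨-zeroʳ y = ∧-zeroʳ (not (x ∨ false))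

  -- Once a letter M > x + 1 has been read, a later rise above x would complete a 201.
  descended-nonincreasing : ∀ w x M → suc x < M →
    catStep x w ∧ (not (completes201 x w ∨ contains201 w) ∧ not (between x M w ∨ completes201 M w))
      ≡ nonincreasing x w
  descended-nonincreasing []      x M _  = refl
  descended-nonincreasing (y ∷ w) x M lt with y ≤ᵇ suc x in y≤x+1
  ... | false rewrite ≤ᵇ-false {y} {x} (<-trans (n<1+n x) (≤ᵇ≡false⇒> y≤x+1)) = refl
  ... | true with y ≤ᵇ x in y≤x
  ...   | false rewrite ≤-antisym {y} {suc x} (≤ᵇ≡true⇒≤ y≤x+1) (≤ᵇ≡false⇒> y≤x)
                      | <ᵇ-true {suc x} {M} lt | <ᵇ-true {x} {suc x} (n<1+n x)
                      | ∧-zeroʳ (not (completes201 x (suc x ∷ w) ∨ contains201 (suc x ∷ w))) = ∧-zeroʳ (catStep (suc x) w)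
  ...   | true with nonincreasing y w in ni
  ...     | true  rewrite nonincreasing-between y y x w ni ≤-refl | nonincreasing-completes201 y x w ni
                        | nonincreasing-between y x M w ni (≤ᵇ≡true⇒≤ y≤x) | <ᵇ-false {x} {y} (≤ᵇ≡true⇒≤ y≤x)
                        | ∧-zeroʳ (y <ᵇ M)
                        = trans (descended-nonincreasing w y M (≤-<-trans (s≤s (≤ᵇ≡true⇒≤ y≤x)) lt)) ni
  ...     | false = weaken-false (catStep y w) (between y x w ∨ completes201 x w) (completes201 y w ∨ contains201 w)
                                   (((y <ᵇ M) ∧ (x <ᵇ y)) ∨ between x M w) (between y M w ∨ completes201 M w)
                      (trans (descended-nonincreasing w y M (≤-<-trans (s≤s (≤ᵇ≡true⇒≤ y≤x)) lt)) ni)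

  -- top: the previous letter p is the largest letter so far; dip: it is one less than the largest;
  -- down: some letter at least two below the largest has been read, and from then on the word
  -- must be nonincreasing.
  data State201 : Set where
    top dip down : State201

  step201 : State201 → Position → Maybe State201
  step201 top  farBelow  = just down
  step201 top  justBelow = just dip
  step201 top  same      = just top
  step201 top  justAbove = just top
  step201 dip  farBelow  = just down
  step201 dip  justBelow = just down
  step201 dip  same      = just dip
  step201 dip  justAbove = just top
  step201 down farBelow  = just down
  step201 down justBelow = just down
  step201 down same      = just down
  step201 _    _         = nothing

  safe201 : ℕ → ℕ → Word → Bool
  safe201 M p w = catStep p w ∧ (not (contains201 w) ∧ not (completes201 M w))

  valid201 : State201 → ℕ → Word → Bool
  valid201 top  p = safe201 p p
  valid201 dip  p = safe201 (suc p) p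
  valid201 down p = nonincreasing p

  drop-implied : ∀ c a n b → (a ≡ true → b ≡ true) → c ∧ (not (a ∨ n) ∧ not b) ≡ c ∧ (not n ∧ not b)
  drop-implied c false n b     _   = refl
  drop-implied c true  n true  _   rewrite ∧-zeroʳ (not n) = refl
  drop-implied c true  n false a⇒b with a⇒b refl
  ... | ()

  swap-implied : ∀ c a n b → (b ≡ true → a ≡ true) → c ∧ (not (a ∨ n) ∧ not b) ≡ c ∧ (not n ∧ not a)
  swap-implied c false n false _   = refl
  swap-implied c true  n b     _   rewrite ∧-zeroʳ (not n) = refl
  swap-implied c false n true  b⇒a with b⇒a refl
  ... | ()

  safe201-∷ : ∀ M {p x} w → x ≤ suc p → safe201 M p (x ∷ w)
    ≡ catStep x w ∧ (not (completes201 x w ∨ contains201 w) ∧ not (between x M w ∨ completes201 M w))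
  safe201-∷ M {p} {x} w x≤p+1 rewrite ≤ᵇ-true {x} {suc p} x≤p+1 = refl

  safe201-descent : ∀ M {p x} w → suc x < M → x ≤ suc p → safe201 M p (x ∷ w) ≡ nonincreasing x w
  safe201-descent M w x+1<M x≤p+1 = trans (safe201-∷ M w x≤p+1) (descended-nonincreasing w _ M x+1<M)

  safe201-step : ∀ M {p x} w → x ≤ suc p → M ≤ suc x → (completes201 x w ≡ true → completes201 M w ≡ true) →
                 safe201 M p (x ∷ w) ≡ safe201 M x w
  safe201-step M {p} {x} w x≤p+1 M≤x+1 x⇒M rewrite safe201-∷ M w x≤p+1 | between-adjacent x M w M≤x+1 =
    drop-implied (catStep x w) (completes201 x w) (contains201 w) (completes201 M w) x⇒M

  safe201-rise : ∀ p w → safe201 p p (suc p ∷ w) ≡ safe201 (suc p) (suc p) w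
  safe201-rise p w rewrite safe201-∷ p w (≤-refl {suc p}) | between-adjacent (suc p) p w (≤-trans (n≤1+n p) (n≤1+n (suc p))) =
    swap-implied (catStep (suc p) w) (completes201 (suc p) w) (contains201 w) (completes201 p w) (completes201-suc p w)

  safe201-far : ∀ M {p x} w → suc p < x → safe201 M p (x ∷ w) ≡ false
  safe201-far M {p} {x} w p+1<x rewrite ≤ᵇ-false {x} {suc p} p+1<x = refl

  nonincreasing-≤ : ∀ {x p} w → x ≤ p → nonincreasing p (x ∷ w) ≡ nonincreasing x w
  nonincreasing-≤ {x} {p} w x≤p rewrite ≤ᵇ-true {x} {p} x≤p = refl

  nonincreasing-> : ∀ {x p} w → p < x → nonincreasing p (x ∷ w) ≡ false
  nonincreasing-> {x} {p} w p<x rewrite ≤ᵇ-false {x} {p} p<x = refl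

  valid201-∷ : ∀ s p x w → valid201 s p (x ∷ w) ≡ maybe′ (λ s′ → valid201 s′ x w) false (step201 s (position x p))
  valid201-∷ s p x w with position x p | position-spec x p
  valid201-∷ top  p x w | farBelow  | farBelow lt = safe201-descent p w lt (<⇒≤ (<-trans (<-trans (n<1+n x) lt) (n<1+n p)))
  valid201-∷ top  _ x w | justBelow | justBelow   =
    safe201-step (suc x) w (≤-trans (n≤1+n x) (n≤1+n (suc x))) ≤-refl (completes201-suc x w)
  valid201-∷ top  _ x w | same      | same        = safe201-step x w (n≤1+n x) (n≤1+n x) (λ h → h)
  valid201-∷ top  p _ w | justAbove | justAbove   = safe201-rise p w
  valid201-∷ top  p x w | farAbove  | farAbove lt = safe201-far p w lt
  valid201-∷ dip  p x w | farBelow  | farBelow lt =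
    safe201-descent (suc p) w (<-trans lt (n<1+n p)) (<⇒≤ (<-trans (<-trans (n<1+n x) lt) (n<1+n p)))
  valid201-∷ dip  _ x w | justBelow | justBelow   =
    safe201-descent (suc (suc x)) w (n<1+n (suc x)) (≤-trans (n≤1+n x) (n≤1+n (suc x)))
  valid201-∷ dip  _ x w | same      | same        = safe201-step (suc x) w (n≤1+n x) ≤-refl (completes201-suc x w)
  valid201-∷ dip  p _ w | justAbove | justAbove   = safe201-step (suc p) w ≤-refl (n≤1+n (suc p)) (λ h → h)
  valid201-∷ dip  p x w | farAbove  | farAbove lt = safe201-far (suc p) w lt
  valid201-∷ down p x w | farBelow  | farBelow lt = nonincreasing-≤ w (<⇒≤ (<-trans (n<1+n x) lt))
  valid201-∷ down _ x w | justBelow | justBelow   = nonincreasing-≤ w (n≤1+n x)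
  valid201-∷ down _ x w | same      | same        = nonincreasing-≤ w ≤-refl
  valid201-∷ down p _ w | justAbove | justAbove   = nonincreasing-> w (n<1+n p)
  valid201-∷ down p x w | farAbove  | farAbove lt = nonincreasing-> w (<-trans (n<1+n p) lt)

  open Run step201 public

  step201-farAbove : ∀ s → step201 s farAbove ≡ nothing
  step201-farAbove top  = refl
  step201-farAbove dip  = refl
  step201-farAbove down = refl

  runs201 : ∀ s p w → runs s p w ≡ valid201 s p w
  runs201 = runs-unique valid201 (λ { top _ → refl ; dip _ → refl ; down _ → refl }) valid201-∷

  completes201-0 : ∀ w → completes201 0 w ≡ false
  completes201-0 []      = refl
  completes201-0 (y ∷ w) rewrite between-adjacent y 0 w z≤n = completes201-0 w

  characterisation201 : ∀ w → catStep 0 w ∧ avoids p201 (0 ∷ w) ≡ runs top 0 w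
  characterisation201 w rewrite runs201 top 0 w | contains-p201 (0 ∷ w) | completes201-0 w =
    sym (cong (catStep 0 w ∧_) (∧-identityʳ (not (contains201 w))))

  cnk-p201 : ∀ L k → cnk p201 (suc L) k ≡ tally top 0 L k
  cnk-p201 = cnk≡tally step201-farAbove p201 top characterisation201

  lowerDescents : ℕ → ℕ → ℕ → ℕ
  lowerDescents p L = descend 0 (λ k → sumBelow p (λ x → tally down x L k))

  tally-down : ∀ p L k → tally down p (suc L) k ≡ lowerDescents p L k + tally down p L k
  tally-down p L k =
    trans (cong₂ _+_ (cong₂ _+_ (sum-tallyVia-below {down} p L k refl refl) (tallyVia-same {down} p L k refl))
                     (tallyVia-rejected {down} p L k refl))
          (+-identityʳ _)

  tally-dip : ∀ p L k → tally dip p (suc L) k ≡ lowerDescents p L k + tally dip p L k + tally top (suc p) L k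
  tally-dip p L k =
    cong₂ _+_ (cong₂ _+_ (sum-tallyVia-below {dip} p L k refl refl) (tallyVia-same {dip} p L k refl))
              (tallyVia-justAbove {dip} p L k refl)

  tally-top-0 : ∀ L k → tally top 0 (suc L) k ≡ tally top 0 L k + tally top 1 L k
  tally-top-0 L k = cong₂ _+_ (tallyVia-same {top} 0 L k refl) (tallyVia-justAbove {top} 0 L k refl)

  tally-top-suc : ∀ m L k → tally top (suc m) (suc L) k
    ≡ lowerDescents m L k + descend 0 (tally dip m L) k + tally top (suc m) L k + tally top (suc (suc m)) L k
  tally-top-suc m L k =
    cong₂ _+_ (cong₂ _+_ (cong₂ _+_ (sum-tallyVia-farBelow {top} m L k refl) (tallyVia-justBelow {top} m L k refl))
                         (tallyVia-same {top} (suc m) L k refl))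
              (tallyVia-justAbove {top} (suc m) L k refl)

module PowerSeries where

  open import Data.Integer using (ℤ; +_; _+_; _-_)
  open Counting using (sumBelow)
  open Automata using (descend)
  open import Data.Integer.Properties using (+-identityˡ; pos-+)
  open import Data.Integer.Tactic.RingSolver using (solve-∀)
  open import Data.Bool using (if_then_else_)
  open import Data.Nat using (ℕ; zero; suc; _<_; s≤s; _≡ᵇ_)
  open import Data.Nat.Properties using (≤-refl; ≤-pred; m≤n⇒m<n∨m≡n; <-trans; n<1+n)
  open import Data.Sum using (inj₁; inj₂)
  open import Relation.Binary.PropositionalEquality using (_≡_; refl; trans; cong; cong₂)

  -- A bivariate power series as its array of coefficients: f L k is the coefficient of xᴸ yᵏ.
  Seq : Set
  Seq = ℕ → ℕ → ℤ

  infix 4 _≈_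
  _≈_ : Seq → Seq → Set
  f ≈ g = ∀ L k → f L k ≡ g L k

  Null : Seq → Set
  Null f = ∀ L k → f L k ≡ + 0

  𝟙 : Seq
  𝟙 zero zero    = + 1
  𝟙 zero (suc _) = + 0
  𝟙 (suc _) _    = + 0

  unit-row : ∀ k → + (if k ≡ᵇ 0 then 1 else 0) ≡ 𝟙 0 k
  unit-row zero    = refl
  unit-row (suc k) = refl

  infixr 8 x·_ y·_
  x·_ : Seq → Seq
  (x· f) zero    k = + 0
  (x· f) (suc L) k = f L k

  y·_ : Seq → Seq
  (y· f) L zero    = + 0
  (y· f) L (suc k) = f L k

  infixl 6 _⊕_ _⊖_
  _⊕_ _⊖_ : Seq → Seq → Seq
  (f ⊕ g) L k = f L k + g L k
  (f ⊖ g) L k = f L k - g L k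

  infixr 8 [1-x]·_ [1-x+xy]·_ [1-2x]·_ Q·_ D·_ W·_
  [1-x]·_ [1-x+xy]·_ [1-2x]·_ Q·_ D·_ W·_ : Seq → Seq
  [1-x]· f    = f ⊖ x· f
  [1-x+xy]· f = f ⊖ x· f ⊕ x· y· f
  [1-2x]· f   = f ⊖ x· f ⊖ x· f
  Q· f        = f ⊖ x· f ⊖ x· f ⊕ x· x· f ⊖ x· x· y· f
  D· f        = Q· f ⊖ x· Q· f ⊖ x· Q· f ⊖ x· x· y· f
  W· f        = f ⊖ x· f ⊖ x· f ⊖ x· f ⊕ x· x· f ⊕ x· x· f ⊖ x· x· y· f

  Σ< : ℕ → (ℕ → Seq) → Seq
  Σ< zero    F L k = + 0
  Σ< (suc n) F L k = Σ< n F L k + F n L k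

  null⇒≈ : ∀ {f g} → Null (f ⊖ g) → f ≈ g
  null⇒≈ {f} {g} null L k = trans (split (f L k) (g L k)) (trans (cong (_+ g L k) (null L k)) (+-identityˡ (g L k)))
    where
    split : ∀ a b → a ≡ (a - b) + b
    split = solve-∀

  NullBelow : ℕ → Seq → Set
  NullBelow n f = ∀ L → L < n → ∀ k → f L k ≡ + 0

  nullBelow-⊕ : ∀ {n f g} → NullBelow n f → NullBelow n g → NullBelow n (f ⊕ g)
  nullBelow-⊕ nf ng L L<n k rewrite nf L L<n k | ng L L<n k = refl

  nullBelow-⊖ : ∀ {n f g} → NullBelow n f → NullBelow n g → NullBelow n (f ⊖ g)
  nullBelow-⊖ nf ng L L<n k rewrite nf L L<n k | ng L L<n k = refl

  nullBelow-y· : ∀ {n f} → NullBelow n f → NullBelow n (y· f)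
  nullBelow-y· nf L L<n zero    = refl
  nullBelow-y· nf L L<n (suc k) = nf L L<n k

  nullBelow-x· : ∀ {n f} → NullBelow n f → NullBelow (suc n) (x· f)
  nullBelow-x· nf zero    _         k = refl
  nullBelow-x· nf (suc L) (s≤s L<n) k = nf L L<n k

  nullBelow-x·′ : ∀ {n f} → NullBelow n f → NullBelow n (x· f)
  nullBelow-x·′ nf zero    _      k = refl
  nullBelow-x·′ nf (suc L) 1+L<n k = nf L (<-trans (n<1+n L) 1+L<n) k

  null-by-recurrence : {I : Set} (f g : I → Seq) → (∀ i → Null (f i ⊖ x· g i)) →
                       (∀ n → (∀ j → NullBelow n (f j)) → ∀ i → NullBelow n (g i)) → ∀ i → Null (f i)
  null-by-recurrence {I} f g step propagate i L = below (suc L) i L ≤-refl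
    where
    below : ∀ n i → NullBelow n (f i)
    below (suc n) i L L<1+n k with m≤n⇒m<n∨m≡n (≤-pred L<1+n)
    ... | inj₁ L<n  = below n i L L<n k
    ... | inj₂ refl =
      trans (split (f i L k) ((x· g i) L k))
            (cong₂ _+_ (step i L k) (nullBelow-x· (propagate L (λ j → below L j) i) L ≤-refl k))
      where
      split : ∀ a b → a ≡ (a - b) + b
      split = solve-∀

  recurrence-null : ∀ f g → (∀ k → f 0 k ≡ 𝟙 0 k) → (∀ L k → f (suc L) k ≡ g L k) → Null (f ⊖ 𝟙 ⊖ x· g)
  recurrence-null f g initial step zero    k rewrite initial k = cancel (𝟙 0 k)
    where
    cancel : ∀ a → a - a - + 0 ≡ + 0
    cancel = solve-∀
  recurrence-null f g initial step (suc L) k rewrite step L k = cancel (g L k)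
    where
    cancel : ∀ a → a - + 0 - a ≡ + 0
    cancel = solve-∀

  pos-Σ< : ∀ n (h : ℕ → ℕ → ℕ → ℕ) L k → + sumBelow n (λ x → h x L k) ≡ Σ< n (λ x L k → + h x L k) L k
  pos-Σ< zero    h L k = refl
  pos-Σ< (suc n) h L k = trans (pos-+ (sumBelow n (λ x → h x L k)) (h n L k)) (cong (_+ + h n L k) (pos-Σ< n h L k))

  pos-y·Σ< : ∀ n (h : ℕ → ℕ → ℕ → ℕ) L k →
    + descend 0 (λ k → sumBelow n (λ x → h x L k)) k ≡ (y· Σ< n (λ x L k → + h x L k)) L k
  pos-y·Σ< n h L zero    = refl
  pos-y·Σ< n h L (suc k) = pos-Σ< n h L k

  pos-y· : ∀ (h : ℕ → ℕ → ℕ) L k → + descend 0 (h L) k ≡ (y· (λ L k → + h L k)) L k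
  pos-y· h L zero    = refl
  pos-y· h L (suc k) = refl

module LinearIdentities where

  open PowerSeries
  open import Data.Bool using (Bool; true; false; _∧_; if_then_else_; T)
  open import Data.Integer using (ℤ; +_; _+_; _-_; -_; _*_)
  open import Data.Integer.Properties
    using (+-identityˡ; +-identityʳ; +-assoc; +-comm; *-identityˡ; *-zeroˡ; *-zeroʳ; *-distribʳ-+;
           neg-distribˡ-*; neg-distrib-+; +-inverseʳ)
  open import Data.List using (List; []; _∷_; _++_; map; length)
  open import Data.List.Relation.Unary.All using (All; []; _∷_)
  open import Data.Nat using (ℕ; zero; suc; _∸_; _≤ᵇ_; _≡ᵇ_)
  open import Data.Nat.Properties using (≡ᵇ⇒≡)
  open import Data.Product using (_×_; _,_; proj₁; proj₂)
  open import Data.Unit using (⊤; tt)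
  open import Relation.Binary.PropositionalEquality using (_≡_; refl; sym; trans; cong; cong₂; subst)

  infixr 8 ‵x·_ ‵y·_ ‵[1-x]·_ ‵[1-x+xy]·_ ‵[1-2x]·_ ‵Q·_ ‵D·_ ‵W·_
  infixl 6 _‵+_ _‵-_
  data LinExpr : Set where
    ‵_        : ℕ → LinExpr
    ‵x·_ ‵y·_ : LinExpr → LinExpr
    _‵+_ _‵-_ : LinExpr → LinExpr → LinExpr

  ⟦_⟧ : LinExpr → (ℕ → Seq) → Seq
  ⟦ ‵ i    ⟧ ρ = ρ i
  ⟦ ‵x· e  ⟧ ρ = x· ⟦ e ⟧ ρ
  ⟦ ‵y· e  ⟧ ρ = y· ⟦ e ⟧ ρ
  ⟦ e ‵+ f ⟧ ρ = ⟦ e ⟧ ρ ⊕ ⟦ f ⟧ ρ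
  ⟦ e ‵- f ⟧ ρ = ⟦ e ⟧ ρ ⊖ ⟦ f ⟧ ρ

  ‵[1-x]·_ ‵[1-x+xy]·_ ‵[1-2x]·_ ‵Q·_ ‵D·_ ‵W·_ : LinExpr → LinExpr
  ‵[1-x]· e    = e ‵- ‵x· e
  ‵[1-x+xy]· e = e ‵- ‵x· e ‵+ ‵x· ‵y· e
  ‵[1-2x]· e   = e ‵- ‵x· e ‵- ‵x· e
  ‵Q· e        = e ‵- ‵x· e ‵- ‵x· e ‵+ ‵x· ‵x· e ‵- ‵x· ‵x· ‵y· e
  ‵D· e        = ‵Q· e ‵- ‵x· ‵Q· e ‵- ‵x· ‵Q· e ‵- ‵x· ‵x· ‵y· e
  ‵W· e        = e ‵- ‵x· e ‵- ‵x· e ‵- ‵x· e ‵+ ‵x· ‵x· e ‵+ ‵x· ‵x· e ‵- ‵x· ‵x· ‵y· e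

  record Monomial : Set where
    constructor mono
    field
      atom xPow yPow : ℕ
      coeff          : ℤ

  raiseX raiseY negate : Monomial → Monomial
  raiseX (mono i a b c) = mono i (suc a) b c
  raiseY (mono i a b c) = mono i a (suc b) c
  negate (mono i a b c) = mono i a b (- c)

  monomials : LinExpr → List Monomial
  monomials (‵ i)    = mono i 0 0 (+ 1) ∷ []
  monomials (‵x· e)  = map raiseX (monomials e)
  monomials (‵y· e)  = map raiseY (monomials e)
  monomials (e ‵+ f) = monomials e ++ monomials f
  monomials (e ‵- f) = monomials e ++ map negate (monomials f)

  shifted : (ℕ → Seq) → ℕ → ℕ → ℕ → Seq
  shifted ρ i a b L k = if (a ≤ᵇ L) ∧ (b ≤ᵇ k) then ρ i (L ∸ a) (k ∸ b) else + 0

  evalMonomial : Monomial → (ℕ → Seq) → Seq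
  evalMonomial (mono i a b c) ρ L k = c * shifted ρ i a b L k

  eval : List Monomial → (ℕ → Seq) → Seq
  eval []       ρ L k = + 0
  eval (m ∷ ms) ρ L k = evalMonomial m ρ L k + eval ms ρ L k

  eval-++ : ∀ ms ns ρ L k → eval (ms ++ ns) ρ L k ≡ eval ms ρ L k + eval ns ρ L k
  eval-++ []       ns ρ L k = sym (+-identityˡ _)
  eval-++ (m ∷ ms) ns ρ L k rewrite eval-++ ms ns ρ L k = sym (+-assoc (evalMonomial m ρ L k) _ _)

  eval-negate : ∀ ms ρ L k → eval (map negate ms) ρ L k ≡ - eval ms ρ L k
  eval-negate []                 ρ L k = refl
  eval-negate (mono i a b c ∷ ms) ρ L k rewrite eval-negate ms ρ L k =
    trans (cong (_+ - eval ms ρ L k) (sym (neg-distribˡ-* c (shifted ρ i a b L k))))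
          (sym (neg-distrib-+ (c * shifted ρ i a b L k) (eval ms ρ L k)))

  eval-raiseX-0 : ∀ ms ρ k → eval (map raiseX ms) ρ 0 k ≡ + 0
  eval-raiseX-0 []                 ρ k = refl
  eval-raiseX-0 (mono i a b c ∷ ms) ρ k rewrite eval-raiseX-0 ms ρ k = trans (+-identityʳ _) (*-zeroʳ c)

  ≤ᵇ-suc : ∀ a L → (suc a ≤ᵇ suc L) ≡ (a ≤ᵇ L)
  ≤ᵇ-suc zero    L = refl
  ≤ᵇ-suc (suc a) L = refl

  eval-raiseX : ∀ ms ρ L k → eval (map raiseX ms) ρ (suc L) k ≡ eval ms ρ L k
  eval-raiseX []                 ρ L k = refl
  eval-raiseX (mono i a b c ∷ ms) ρ L k rewrite eval-raiseX ms ρ L k | ≤ᵇ-suc a L = refl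

  eval-raiseY-0 : ∀ ms ρ L → eval (map raiseY ms) ρ L 0 ≡ + 0
  eval-raiseY-0 []                 ρ L = refl
  eval-raiseY-0 (mono i a b c ∷ ms) ρ L rewrite eval-raiseY-0 ms ρ L with a ≤ᵇ L
  ... | true  = trans (+-identityʳ _) (*-zeroʳ c)
  ... | false = trans (+-identityʳ _) (*-zeroʳ c)

  eval-raiseY : ∀ ms ρ L k → eval (map raiseY ms) ρ L (suc k) ≡ eval ms ρ L k
  eval-raiseY []                 ρ L k = refl
  eval-raiseY (mono i a b c ∷ ms) ρ L k rewrite eval-raiseY ms ρ L k | ≤ᵇ-suc b k = refl

  monomials-sound : ∀ e ρ → ⟦ e ⟧ ρ ≈ eval (monomials e) ρ
  monomials-sound (‵ i)    ρ L       k       = sym (trans (+-identityʳ _) (*-identityˡ _))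
  monomials-sound (‵x· e)  ρ zero    k       = sym (eval-raiseX-0 (monomials e) ρ k)
  monomials-sound (‵x· e)  ρ (suc L) k       = trans (monomials-sound e ρ L k) (sym (eval-raiseX (monomials e) ρ L k))
  monomials-sound (‵y· e)  ρ L       zero    = sym (eval-raiseY-0 (monomials e) ρ L)
  monomials-sound (‵y· e)  ρ L       (suc k) = trans (monomials-sound e ρ L k) (sym (eval-raiseY (monomials e) ρ L k))
  monomials-sound (e ‵+ f) ρ L       k       =
    trans (cong₂ _+_ (monomials-sound e ρ L k) (monomials-sound f ρ L k)) (sym (eval-++ (monomials e) (monomials f) ρ L k))
  monomials-sound (e ‵- f) ρ L       k       =
    trans (cong₂ _-_ (monomials-sound e ρ L k) (monomials-sound f ρ L k))
          (sym (trans (eval-++ (monomials e) (map negate (monomials f)) ρ L k)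
                      (cong (λ t → eval (monomials e) ρ L k + t) (eval-negate (monomials f) ρ L k))))

  similar : ℕ → ℕ → ℕ → Monomial → Bool
  similar i a b (mono i′ a′ b′ _) = (i ≡ᵇ i′) ∧ ((a ≡ᵇ a′) ∧ (b ≡ᵇ b′))

  collect : ℕ → ℕ → ℕ → List Monomial → ℤ × List Monomial
  collect i a b []       = + 0 , []
  collect i a b (m ∷ ms) with similar i a b m
  ... | true  = Monomial.coeff m + proj₁ (collect i a b ms) , proj₂ (collect i a b ms)
  ... | false = proj₁ (collect i a b ms) , m ∷ proj₂ (collect i a b ms)

  similar-sound : ∀ i a b m → similar i a b m ≡ true → ∀ ρ L k → evalMonomial m ρ L k ≡ Monomial.coeff m * shifted ρ i a b L k
  similar-sound i a b (mono i′ a′ b′ c) h ρ L k with i ≡ᵇ i′ in e₁ | a ≡ᵇ a′ in e₂ | b ≡ᵇ b′ in e₃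
  ... | true | true | true
    rewrite ≡ᵇ⇒≡ i i′ (subst T (sym e₁) _) | ≡ᵇ⇒≡ a a′ (subst T (sym e₂) _)
          | ≡ᵇ⇒≡ b b′ (subst T (sym e₃) _) = refl

  collect-sound : ∀ i a b ms ρ L k →
    eval ms ρ L k ≡ proj₁ (collect i a b ms) * shifted ρ i a b L k + eval (proj₂ (collect i a b ms)) ρ L k
  collect-sound i a b []       ρ L k = sym (trans (+-identityʳ _) (*-zeroˡ (shifted ρ i a b L k)))
  collect-sound i a b (m ∷ ms) ρ L k with similar i a b m in sim
  ... | true  rewrite collect-sound i a b ms ρ L k | similar-sound i a b m sim ρ L k =
    trans (sym (+-assoc (Monomial.coeff m * s) (c * s) r)) (cong (_+ r) (sym (*-distribʳ-+ s (Monomial.coeff m) c)))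
    where
    s = shifted ρ i a b L k
    c = proj₁ (collect i a b ms)
    r = eval (proj₂ (collect i a b ms)) ρ L k
  ... | false rewrite collect-sound i a b ms ρ L k =
    trans (sym (+-assoc (evalMonomial m ρ L k) (c * s) r))
          (trans (cong (_+ r) (+-comm (evalMonomial m ρ L k) (c * s))) (+-assoc (c * s) (evalMonomial m ρ L k) r))
    where
    s = shifted ρ i a b L k
    c = proj₁ (collect i a b ms)
    r = eval (proj₂ (collect i a b ms)) ρ L k

  isZero : ℤ → Bool
  isZero (+ zero) = true
  isZero _        = false

  cancels : ℕ → List Monomial → Bool
  cancels _       []                    = true
  cancels zero    (_ ∷ _)               = false
  cancels (suc n) ms@(mono i a b _ ∷ _) = isZero (proj₁ (collect i a b ms)) ∧ cancels n (proj₂ (collect i a b ms))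

  cancels-sound : ∀ n ms → cancels n ms ≡ true → ∀ ρ → Null (eval ms ρ)
  cancels-sound n       []                  _ ρ L k = refl
  cancels-sound (suc n) ms@(mono i a b _ ∷ _) h ρ L k
    with isZero (proj₁ (collect i a b ms)) in zero-coeff | cancels n (proj₂ (collect i a b ms)) in rest
  ... | true | true = trans (collect-sound i a b ms ρ L k)
    (trans (cong₂ _+_ (trans (cong (_* shifted ρ i a b L k) (isZero-sound _ zero-coeff)) (*-zeroˡ (shifted ρ i a b L k)))
                      (cancels-sound n (proj₂ (collect i a b ms)) rest ρ L k))
           refl)
    where
    isZero-sound : ∀ z → isZero z ≡ true → z ≡ + 0
    isZero-sound (+ zero) _ = refl

  eval-identity : ∀ ms ns → let ds = ms ++ map negate ns in cancels (length ds) ds ≡ true → ∀ ρ → eval ms ρ ≈ eval ns ρ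
  eval-identity ms ns h ρ = null⇒≈ λ L k →
    trans (cong (λ t → eval ms ρ L k + t) (sym (eval-negate ns ρ L k)))
          (trans (sym (eval-++ ms (map negate ns) ρ L k))
                 (cancels-sound (length (ms ++ map negate ns)) (ms ++ map negate ns) h ρ L k))

  provablyEqual : LinExpr → LinExpr → Bool
  provablyEqual e f = cancels (length (monomials (e ‵- f))) (monomials (e ‵- f))

  linear-identity : ∀ e f → provablyEqual e f ≡ true → ∀ ρ → ⟦ e ⟧ ρ ≈ ⟦ f ⟧ ρ
  linear-identity e f h ρ L k =
    trans (monomials-sound e ρ L k) (trans (eval-identity (monomials e) (monomials f) h ρ L k) (sym (monomials-sound f ρ L k)))

  relation : ℕ → List LinExpr → LinExpr
  relation _       []       = ‵ 0 ‵- ‵ 0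
  relation zero    (r ∷ rs) = r
  relation (suc i) (r ∷ rs) = relation i rs

  infixl 9 _⟨_⟩
  _⟨_⟩ : LinExpr → List LinExpr → LinExpr
  (‵ i)    ⟨ rs ⟩ = relation i rs
  (‵x· c)  ⟨ rs ⟩ = ‵x· c ⟨ rs ⟩
  (‵y· c)  ⟨ rs ⟩ = ‵y· c ⟨ rs ⟩
  (c ‵+ d) ⟨ rs ⟩ = c ⟨ rs ⟩ ‵+ d ⟨ rs ⟩
  (c ‵- d) ⟨ rs ⟩ = c ⟨ rs ⟩ ‵- d ⟨ rs ⟩

  null-⟦⟧ : ∀ c σ → (∀ i → Null (σ i)) → Null (⟦ c ⟧ σ)
  null-⟦⟧ (‵ i)    σ nulls L       k       = nulls i L k
  null-⟦⟧ (‵x· c)  σ nulls zero    k       = refl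
  null-⟦⟧ (‵x· c)  σ nulls (suc L) k       = null-⟦⟧ c σ nulls L k
  null-⟦⟧ (‵y· c)  σ nulls L       zero    = refl
  null-⟦⟧ (‵y· c)  σ nulls L       (suc k) = null-⟦⟧ c σ nulls L k
  null-⟦⟧ (c ‵+ d) σ nulls L       k       rewrite null-⟦⟧ c σ nulls L k | null-⟦⟧ d σ nulls L k = refl
  null-⟦⟧ (c ‵- d) σ nulls L       k       rewrite null-⟦⟧ c σ nulls L k | null-⟦⟧ d σ nulls L k = refl

  null-relation : ∀ rs ρ → All (λ r → Null (⟦ r ⟧ ρ)) rs → ∀ i → Null (⟦ relation i rs ⟧ ρ)
  null-relation []       ρ []             i       L k = +-inverseʳ (ρ 0 L k)
  null-relation (r ∷ rs) ρ (null ∷ nulls) zero    = null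
  null-relation (r ∷ rs) ρ (null ∷ nulls) (suc i) = null-relation rs ρ nulls i

  null-⟨⟩ : ∀ c rs ρ → All (λ r → Null (⟦ r ⟧ ρ)) rs → Null (⟦ c ⟨ rs ⟩ ⟧ ρ)
  null-⟨⟩ (‵ i)    rs ρ nulls = null-relation rs ρ nulls i
  null-⟨⟩ (‵x· c)  rs ρ nulls = null-⟦⟧ (‵x· ‵ 0) (λ _ → ⟦ c ⟨ rs ⟩ ⟧ ρ) (λ _ → null-⟨⟩ c rs ρ nulls)
  null-⟨⟩ (‵y· c)  rs ρ nulls = null-⟦⟧ (‵y· ‵ 0) (λ _ → ⟦ c ⟨ rs ⟩ ⟧ ρ) (λ _ → null-⟨⟩ c rs ρ nulls)
  null-⟨⟩ (c ‵+ d) rs ρ nulls L k rewrite null-⟨⟩ c rs ρ nulls L k | null-⟨⟩ d rs ρ nulls L k = refl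
  null-⟨⟩ (c ‵- d) rs ρ nulls L k rewrite null-⟨⟩ c rs ρ nulls L k | null-⟨⟩ d rs ρ nulls L k = refl

  -- The certificate c expresses e as a combination of the relations rs, which are null.
  null-by-identity : ∀ e c rs ρ → provablyEqual e (c ⟨ rs ⟩) ≡ true → All (λ r → Null (⟦ r ⟧ ρ)) rs → Null (⟦ e ⟧ ρ)
  null-by-identity e c rs ρ h nulls L k = trans (linear-identity e (c ⟨ rs ⟩) h ρ L k) (null-⟨⟩ c rs ρ nulls L k)

  cancel-[1-2x] : ∀ {f} → Null ([1-2x]· f) → Null f
  cancel-[1-2x] {f} null = null-by-recurrence (λ (_ : ⊤) → f) (λ _ → f ⊕ f) (λ _ → step)
    (λ n below _ → nullBelow-⊕ (below tt) (below tt)) tt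
    where
    step : Null (f ⊖ x· (f ⊕ f))
    step = null-by-identity (‵ 0 ‵- ‵x· (‵ 0 ‵+ ‵ 0)) (‵ 0) (‵[1-2x]· ‵ 0 ∷ []) (λ _ → f) refl (null ∷ [])

  cancel-[1-x] : ∀ {f} → Null ([1-x]· f) → Null f
  cancel-[1-x] {f} null = null-by-recurrence (λ (_ : ⊤) → f) (λ _ → f) (λ _ → null) (λ n below _ → below tt) tt

  cancel-W : ∀ {f} → Null (W· f) → Null f
  cancel-W {f} null = null-by-recurrence (λ (_ : ⊤) → f) (λ _ → g) (λ _ → step)
    (λ n below _ → let b = below tt in
      nullBelow-⊕ (nullBelow-⊖ (nullBelow-⊖ (nullBelow-⊕ (nullBelow-⊕ b b) b) (nullBelow-x·′ b)) (nullBelow-x·′ b))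
                  (nullBelow-x·′ (nullBelow-y· b))) tt
    where
    g : Seq
    g = f ⊕ f ⊕ f ⊖ x· f ⊖ x· f ⊕ x· y· f
    step : Null (f ⊖ x· g)
    step = null-by-identity (‵ 0 ‵- ‵x· (‵ 0 ‵+ ‵ 0 ‵+ ‵ 0 ‵- ‵x· ‵ 0 ‵- ‵x· ‵ 0 ‵+ ‵x· ‵y· ‵ 0)) (‵ 0) (‵W· ‵ 0 ∷ [])
                            (λ _ → f) refl (null ∷ [])

module Series102 where

  open Avoiding102
  open PowerSeries
  open LinearIdentities
  open import Data.Integer using (+_; _+_)
  open import Data.Integer.Properties using (pos-+)
  open import Data.List using ([]; _∷_)
  open import Data.List.Relation.Unary.All using ([]; _∷_)
  open import Data.Nat as ℕ using (ℕ; suc)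
  open import Relation.Binary.PropositionalEquality using (_≡_; refl; trans; cong)

  Low High Asc : ℕ → Seq
  Low  r L k = + tally low r L k
  High r L k = + tally high (suc r) L k
  Asc  v L k = + tally ascending v L k

  pos-+₃ : ∀ a b c → + (a ℕ.+ b ℕ.+ c) ≡ + a + + b + + c
  pos-+₃ a b c = trans (pos-+ (a ℕ.+ b) c) (cong (_+ + c) (pos-+ a b))

  Low-recurrence : ∀ r → Null (Low r ⊖ 𝟙 ⊖ x· (y· Σ< r Low ⊕ Low r ⊕ High r))
  Low-recurrence r = recurrence-null (Low r) _ unit-row λ L k →
    trans (cong +_ (tally-low r L k))
          (trans (pos-+₃ (lowerTails r L k) _ _) (cong (λ t → t + Low r L k + High r L k) (pos-y·Σ< r (tally low) L k)))

  High-recurrence : ∀ r → Null (High r ⊖ 𝟙 ⊖ x· (y· Σ< (suc r) Low ⊕ High r))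
  High-recurrence r = recurrence-null (High r) _ unit-row λ L k →
    trans (cong +_ (tally-high (suc r) L k))
          (trans (pos-+ (lowerTails (suc r) L k) _) (cong (_+ High r L k) (pos-y·Σ< (suc r) (tally low) L k)))

  Asc-recurrence : ∀ v → Null (Asc v ⊖ 𝟙 ⊖ x· (y· Σ< v Low ⊕ Asc v ⊕ Asc (suc v)))
  Asc-recurrence v = recurrence-null (Asc v) _ unit-row λ L k →
    trans (cong +_ (tally-ascending v L k))
          (trans (pos-+₃ (lowerTails v L k) _ _) (cong (λ t → t + Asc v L k + Asc (suc v) L k) (pos-y·Σ< v (tally low) L k)))

  Q-Low₀ : Null (Q· Low 0 ⊖ 𝟙)
  Q-Low₀ = null-by-identity (‵Q· T ‵- one) (‵[1-x]· ‵ 0 ‵+ ‵x· ‵ 1 ‵+ ‵x· ‵y· ‵ 2)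
    (T ‵- one ‵- ‵x· (‵y· S ‵+ T ‵+ U) ∷ U ‵- one ‵- ‵x· (‵y· (S ‵+ T) ‵+ U) ∷ S ∷ [])
    env refl (Low-recurrence 0 ∷ High-recurrence 0 ∷ (λ _ _ → refl) ∷ [])
    where
    T U S one : LinExpr
    T = ‵ 0 ; U = ‵ 1 ; S = ‵ 2 ; one = ‵ 3
    env : ℕ → Seq
    env 0 = Low 0
    env 1 = High 0
    env 2 = Σ< 0 Low
    env _ = 𝟙

  Q-Low-step : ∀ r → Null (Q· (Low (suc r) ⊖ Low r) ⊖ x· y· Low r)
  Q-Low-step r = null-by-identity (‵Q· (T′ ‵- T) ‵- ‵x· ‵y· T) (‵[1-x]· (‵ 0 ‵- ‵ 1) ‵+ ‵x· (‵ 2 ‵- ‵ 3))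
    (T′ ‵- one ‵- ‵x· (‵y· (S ‵+ T) ‵+ T′ ‵+ U′) ∷ T ‵- one ‵- ‵x· (‵y· S ‵+ T ‵+ U) ∷
     U′ ‵- one ‵- ‵x· (‵y· (S ‵+ T ‵+ T′) ‵+ U′) ∷ U ‵- one ‵- ‵x· (‵y· (S ‵+ T) ‵+ U) ∷ [])
    env refl (Low-recurrence (suc r) ∷ Low-recurrence r ∷ High-recurrence (suc r) ∷ High-recurrence r ∷ [])
    where
    T T′ U U′ S one : LinExpr
    T = ‵ 0 ; T′ = ‵ 1 ; U = ‵ 2 ; U′ = ‵ 3 ; S = ‵ 4 ; one = ‵ 5
    env : ℕ → Seq
    env 0 = Low r
    env 1 = Low (suc r)
    env 2 = High r
    env 3 = High (suc r)
    env 4 = Σ< r Low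
    env _ = 𝟙

  Δ : ℕ → Seq
  Δ v = Asc (suc v) ⊖ Asc v

  Δ-recurrence : ∀ v → Null (Δ v ⊖ x· (y· Low v ⊕ Δ v ⊕ Δ (suc v)))
  Δ-recurrence v = null-by-identity ((A₁ ‵- A₀) ‵- ‵x· (‵y· T ‵+ (A₁ ‵- A₀) ‵+ (A₂ ‵- A₁))) (‵ 0 ‵- ‵ 1)
    (A₁ ‵- one ‵- ‵x· (‵y· (S ‵+ T) ‵+ A₁ ‵+ A₂) ∷ A₀ ‵- one ‵- ‵x· (‵y· S ‵+ A₀ ‵+ A₁) ∷ [])
    env refl (Asc-recurrence (suc v) ∷ Asc-recurrence v ∷ [])
    where
    A₀ A₁ A₂ T S one : LinExpr
    A₀ = ‵ 0 ; A₁ = ‵ 1 ; A₂ = ‵ 2 ; T = ‵ 3 ; S = ‵ 4 ; one = ‵ 5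
    env : ℕ → Seq
    env 0 = Asc v
    env 1 = Asc (suc v)
    env 2 = Asc (suc (suc v))
    env 3 = Low v
    env 4 = Σ< v Low
    env _ = 𝟙

  Δ-ratio : ∀ v → Null (Q· Δ (suc v) ⊖ Q· Δ v ⊖ x· y· Δ v)
  Δ-ratio = null-by-recurrence E (λ v → E v ⊕ E (suc v)) step
    (λ n below v → nullBelow-⊕ (below v) (below (suc v)))
    where
    E : ℕ → Seq
    E v = Q· Δ (suc v) ⊖ Q· Δ v ⊖ x· y· Δ v
    step : ∀ v → Null (E v ⊖ x· (E v ⊕ E (suc v)))
    step v = null-by-identity (E₀ ‵- ‵x· (E₀ ‵+ E₁)) (‵Q· (‵ 1 ‵- ‵ 0) ‵- ‵x· ‵y· ‵ 0 ‵+ ‵x· ‵y· ‵ 2)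
      (D₀ ‵- ‵x· (‵y· T ‵+ D₀ ‵+ D₁) ∷ D₁ ‵- ‵x· (‵y· T′ ‵+ D₁ ‵+ D₂) ∷ ‵Q· (T′ ‵- T) ‵- ‵x· ‵y· T ∷ [])
      env refl (Δ-recurrence v ∷ Δ-recurrence (suc v) ∷ Q-Low-step v ∷ [])
      where
      T T′ D₀ D₁ D₂ E₀ E₁ : LinExpr
      T = ‵ 4 ; T′ = ‵ 5
      D₀ = ‵ 1 ‵- ‵ 0 ; D₁ = ‵ 2 ‵- ‵ 1 ; D₂ = ‵ 3 ‵- ‵ 2
      E₀ = ‵Q· D₁ ‵- ‵Q· D₀ ‵- ‵x· ‵y· D₀
      E₁ = ‵Q· D₂ ‵- ‵Q· D₁ ‵- ‵x· ‵y· D₁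
      env : ℕ → Seq
      env 0 = Asc v
      env 1 = Asc (suc v)
      env 2 = Asc (suc (suc v))
      env 3 = Asc (suc (suc (suc v)))
      env 4 = Low v
      env _ = Low (suc v)

  D-Δ₀ : Null (D· Δ 0 ⊖ x· y· 𝟙)
  D-Δ₀ = null-by-identity (‵D· D₀ ‵- ‵x· ‵y· one) (‵Q· ‵ 0 ‵+ ‵x· ‵y· ‵ 1 ‵+ ‵x· ‵ 2)
    (D₀ ‵- ‵x· (‵y· T ‵+ D₀ ‵+ D₁) ∷ ‵Q· T ‵- one ∷ ‵Q· D₁ ‵- ‵Q· D₀ ‵- ‵x· ‵y· D₀ ∷ [])
    env refl (Δ-recurrence 0 ∷ Q-Low₀ ∷ Δ-ratio 0 ∷ [])
    where
    T one D₀ D₁ : LinExpr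
    T = ‵ 3 ; one = ‵ 4
    D₀ = ‵ 1 ‵- ‵ 0 ; D₁ = ‵ 2 ‵- ‵ 1
    env : ℕ → Seq
    env 0 = Asc 0
    env 1 = Asc 1
    env 2 = Asc 2
    env 3 = Low 0
    env _ = 𝟙

  D-Asc₀ : Null (D· Asc 0 ⊖ Q· 𝟙)
  D-Asc₀ = cancel-[1-2x] (null-by-identity (‵[1-2x]· (‵D· A₀ ‵- ‵Q· one)) (‵D· ‵ 0 ‵+ ‵D· ‵x· ‵y· ‵ 2 ‵+ ‵x· ‵ 1)
    (A₀ ‵- one ‵- ‵x· (‵y· S ‵+ A₀ ‵+ A₁) ∷ ‵D· (A₁ ‵- A₀) ‵- ‵x· ‵y· one ∷ S ∷ [])
    env refl (Asc-recurrence 0 ∷ D-Δ₀ ∷ (λ _ _ → refl) ∷ []))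
    where
    A₀ A₁ S one : LinExpr
    A₀ = ‵ 0 ; A₁ = ‵ 1 ; S = ‵ 2 ; one = ‵ 3
    env : ℕ → Seq
    env 0 = Asc 0
    env 1 = Asc 1
    env 2 = Σ< 0 Low
    env _ = 𝟙

module Series201 where

  open Avoiding201
  open PowerSeries
  open LinearIdentities
  open import Data.Integer using (+_; _+_)
  open import Data.Integer.Properties using (pos-+)
  open import Data.List using ([]; _∷_)
  open import Data.List.Relation.Unary.All using ([]; _∷_)
  open import Data.Nat as ℕ using (ℕ; suc)
  open import Data.Sum using (_⊎_; inj₁; inj₂)
  open import Relation.Binary.PropositionalEquality using (_≡_; refl; trans; cong; cong₂)

  Down Dip Top : ℕ → Seq
  Down a L k = + tally down a L k
  Dip  m L k = + tally dip m L k
  Top  M L k = + tally top M L k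

  Down-recurrence : ∀ a → Null (Down a ⊖ 𝟙 ⊖ x· (y· Σ< a Down ⊕ Down a))
  Down-recurrence a = recurrence-null (Down a) _ unit-row λ L k →
    trans (cong +_ (tally-down a L k))
          (trans (pos-+ (lowerDescents a L k) _) (cong (_+ Down a L k) (pos-y·Σ< a (tally down) L k)))

  Dip-recurrence : ∀ m → Null (Dip m ⊖ 𝟙 ⊖ x· (y· Σ< m Down ⊕ Dip m ⊕ Top (suc m)))
  Dip-recurrence m = recurrence-null (Dip m) _ unit-row λ L k →
    trans (cong +_ (tally-dip m L k))
          (trans (trans (pos-+ (lowerDescents m L k ℕ.+ _) _) (cong (_+ Top (suc m) L k) (pos-+ (lowerDescents m L k) _)))
                 (cong (λ t → t + Dip m L k + Top (suc m) L k) (pos-y·Σ< m (tally down) L k)))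

  Top-recurrence₀ : Null (Top 0 ⊖ 𝟙 ⊖ x· (Top 0 ⊕ Top 1))
  Top-recurrence₀ = recurrence-null (Top 0) _ unit-row λ L k →
    trans (cong +_ (tally-top-0 L k)) (pos-+ (tally top 0 L k) _)

  Top-recurrence : ∀ m → Null (Top (suc m) ⊖ 𝟙 ⊖ x· (y· Σ< m Down ⊕ y· Dip m ⊕ Top (suc m) ⊕ Top (suc (suc m))))
  Top-recurrence m = recurrence-null (Top (suc m)) _ unit-row λ L k →
    trans (cong +_ (tally-top-suc m L k))
          (trans (pos-+₄ (lowerDescents m L k) _ _ _)
                 (cong₂ (λ s t → s + t + Top (suc m) L k + Top (suc (suc m)) L k)
                        (pos-y·Σ< m (tally down) L k) (pos-y· (tally dip m) L k)))
    where
    pos-+₄ : ∀ a b c d → + (a ℕ.+ b ℕ.+ c ℕ.+ d) ≡ + a + + b + + c + + d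
    pos-+₄ a b c d = trans (pos-+ (a ℕ.+ b ℕ.+ c) d)
      (cong (_+ + d) (trans (pos-+ (a ℕ.+ b) c) (cong (_+ + c) (pos-+ a b))))

  ΔTop ΔDip : ℕ → Seq
  ΔTop j = Top (suc j) ⊖ Top j
  ΔDip j = Dip (suc j) ⊖ Dip j

  Down₀ : Null ([1-x]· Down 0 ⊖ 𝟙)
  Down₀ = null-by-identity (‵[1-x]· D ‵- one) (‵ 0 ‵+ ‵x· ‵y· ‵ 1) (D ‵- one ‵- ‵x· (‵y· S ‵+ D) ∷ S ∷ [])
    env refl (Down-recurrence 0 ∷ (λ _ _ → refl) ∷ [])
    where
    D S one : LinExpr
    D = ‵ 0 ; S = ‵ 1 ; one = ‵ 2
    env : ℕ → Seq
    env 0 = Down 0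
    env 1 = Σ< 0 Down
    env _ = 𝟙

  Down-step : ∀ a → Null ([1-x]· Down (suc a) ⊖ [1-x+xy]· Down a)
  Down-step a = null-by-identity (‵[1-x]· D′ ‵- ‵[1-x+xy]· D) (‵ 0 ‵- ‵ 1)
    (D′ ‵- one ‵- ‵x· (‵y· (S ‵+ D) ‵+ D′) ∷ D ‵- one ‵- ‵x· (‵y· S ‵+ D) ∷ [])
    env refl (Down-recurrence (suc a) ∷ Down-recurrence a ∷ [])
    where
    D D′ S one : LinExpr
    D = ‵ 0 ; D′ = ‵ 1 ; S = ‵ 2 ; one = ‵ 3
    env : ℕ → Seq
    env 0 = Down a
    env 1 = Down (suc a)
    env 2 = Σ< a Down
    env _ = 𝟙

  Top-step₀ : Null (ΔTop 0 ⊖ x· (ΔTop 0 ⊕ ΔTop 1 ⊕ y· Dip 0))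
  Top-step₀ = null-by-identity ((F₁ ‵- F₀) ‵- ‵x· ((F₁ ‵- F₀) ‵+ (F₂ ‵- F₁) ‵+ ‵y· G)) (‵ 0 ‵- ‵ 1 ‵+ ‵x· ‵y· ‵ 2)
    (F₁ ‵- one ‵- ‵x· (‵y· S ‵+ ‵y· G ‵+ F₁ ‵+ F₂) ∷ F₀ ‵- one ‵- ‵x· (F₀ ‵+ F₁) ∷ S ∷ [])
    env refl (Top-recurrence 0 ∷ Top-recurrence₀ ∷ (λ _ _ → refl) ∷ [])
    where
    F₀ F₁ F₂ G S one : LinExpr
    F₀ = ‵ 0 ; F₁ = ‵ 1 ; F₂ = ‵ 2 ; G = ‵ 3 ; S = ‵ 4 ; one = ‵ 5
    env : ℕ → Seq
    env 0 = Top 0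
    env 1 = Top 1
    env 2 = Top 2
    env 3 = Dip 0
    env 4 = Σ< 0 Down
    env _ = 𝟙

  Top-step : ∀ j → Null (ΔTop (suc j) ⊖ x· (ΔTop (suc j) ⊕ ΔTop (suc (suc j)) ⊕ y· ΔDip j ⊕ y· Down j))
  Top-step j = null-by-identity
    ((F₂ ‵- F₁) ‵- ‵x· ((F₂ ‵- F₁) ‵+ (F₃ ‵- F₂) ‵+ ‵y· (G₁ ‵- G₀) ‵+ ‵y· D)) (‵ 0 ‵- ‵ 1)
    (F₂ ‵- one ‵- ‵x· (‵y· (S ‵+ D) ‵+ ‵y· G₁ ‵+ F₂ ‵+ F₃) ∷ F₁ ‵- one ‵- ‵x· (‵y· S ‵+ ‵y· G₀ ‵+ F₁ ‵+ F₂) ∷ [])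
    env refl (Top-recurrence (suc j) ∷ Top-recurrence j ∷ [])
    where
    F₁ F₂ F₃ G₀ G₁ D S one : LinExpr
    F₁ = ‵ 0 ; F₂ = ‵ 1 ; F₃ = ‵ 2 ; G₀ = ‵ 3 ; G₁ = ‵ 4 ; D = ‵ 5 ; S = ‵ 6 ; one = ‵ 7
    env : ℕ → Seq
    env 0 = Top (suc j)
    env 1 = Top (suc (suc j))
    env 2 = Top (suc (suc (suc j)))
    env 3 = Dip j
    env 4 = Dip (suc j)
    env 5 = Down j
    env 6 = Σ< j Down
    env _ = 𝟙

  Dip-step : ∀ j → Null (ΔDip j ⊖ x· (y· Down j ⊕ ΔDip j ⊕ ΔTop (suc j)))
  Dip-step j = null-by-identity ((G₁ ‵- G₀) ‵- ‵x· (‵y· D ‵+ (G₁ ‵- G₀) ‵+ (F₂ ‵- F₁))) (‵ 0 ‵- ‵ 1)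
    (G₁ ‵- one ‵- ‵x· (‵y· (S ‵+ D) ‵+ G₁ ‵+ F₂) ∷ G₀ ‵- one ‵- ‵x· (‵y· S ‵+ G₀ ‵+ F₁) ∷ [])
    env refl (Dip-recurrence (suc j) ∷ Dip-recurrence j ∷ [])
    where
    G₀ G₁ F₁ F₂ D S one : LinExpr
    G₀ = ‵ 0 ; G₁ = ‵ 1 ; F₁ = ‵ 2 ; F₂ = ‵ 3 ; D = ‵ 4 ; S = ‵ 5 ; one = ‵ 6
    env : ℕ → Seq
    env 0 = Dip j
    env 1 = Dip (suc j)
    env 2 = Top (suc j)
    env 3 = Top (suc (suc j))
    env 4 = Down j
    env 5 = Σ< j Down
    env _ = 𝟙

  ratio : ℕ ⊎ ℕ → Seq
  ratio (inj₁ j) = [1-x]· ΔTop (suc (suc j)) ⊖ [1-x+xy]· ΔTop (suc j)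
  ratio (inj₂ j) = [1-x]· ΔDip (suc j) ⊖ [1-x+xy]· ΔDip j

  ratio-null : ∀ i → Null (ratio i)
  ratio-null = null-by-recurrence ratio next step propagate
    where
    next : ℕ ⊎ ℕ → Seq
    next (inj₁ j) = ratio (inj₁ j) ⊕ ratio (inj₁ (suc j)) ⊕ y· ratio (inj₂ j)
    next (inj₂ j) = ratio (inj₂ j) ⊕ ratio (inj₁ j)
    propagate : ∀ n → (∀ i → NullBelow n (ratio i)) → ∀ i → NullBelow n (next i)
    propagate n below (inj₁ j) =
      nullBelow-⊕ (nullBelow-⊕ (below (inj₁ j)) (below (inj₁ (suc j)))) (nullBelow-y· (below (inj₂ j)))
    propagate n below (inj₂ j) = nullBelow-⊕ (below (inj₂ j)) (below (inj₁ j))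
    F₁ F₂ F₃ F₄ G₀ G₁ G₂ D₀ D₁ : LinExpr
    F₁ = ‵ 0 ; F₂ = ‵ 1 ; F₃ = ‵ 2 ; F₄ = ‵ 3 ; G₀ = ‵ 4 ; G₁ = ‵ 5 ; G₂ = ‵ 6 ; D₀ = ‵ 7 ; D₁ = ‵ 8
    ΔF₁ ΔF₂ ΔF₃ ΔG₀ ΔG₁ E H E′ : LinExpr
    ΔF₁ = F₂ ‵- F₁ ; ΔF₂ = F₃ ‵- F₂ ; ΔF₃ = F₄ ‵- F₃ ; ΔG₀ = G₁ ‵- G₀ ; ΔG₁ = G₂ ‵- G₁
    E  = ‵[1-x]· ΔF₂ ‵- ‵[1-x+xy]· ΔF₁
    E′ = ‵[1-x]· ΔF₃ ‵- ‵[1-x+xy]· ΔF₂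
    H  = ‵[1-x]· ΔG₁ ‵- ‵[1-x+xy]· ΔG₀
    env : ℕ → ℕ → Seq
    env j 0 = Top (suc j)
    env j 1 = Top (suc (suc j))
    env j 2 = Top (suc (suc (suc j)))
    env j 3 = Top (suc (suc (suc (suc j))))
    env j 4 = Dip j
    env j 5 = Dip (suc j)
    env j 6 = Dip (suc (suc j))
    env j 7 = Down j
    env j _ = Down (suc j)
    step : ∀ i → Null (ratio i ⊖ x· next i)
    step (inj₁ j) = null-by-identity (E ‵- ‵x· (E ‵+ E′ ‵+ ‵y· H)) (‵[1-x]· ‵ 0 ‵- ‵[1-x+xy]· ‵ 1 ‵+ ‵x· ‵y· ‵ 2)
      (ΔF₂ ‵- ‵x· (ΔF₂ ‵+ ΔF₃ ‵+ ‵y· ΔG₁ ‵+ ‵y· D₁) ∷ ΔF₁ ‵- ‵x· (ΔF₁ ‵+ ΔF₂ ‵+ ‵y· ΔG₀ ‵+ ‵y· D₀) ∷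
       ‵[1-x]· D₁ ‵- ‵[1-x+xy]· D₀ ∷ [])
      (env j) refl (Top-step (suc j) ∷ Top-step j ∷ Down-step j ∷ [])
    step (inj₂ j) = null-by-identity (H ‵- ‵x· (H ‵+ E)) (‵[1-x]· ‵ 0 ‵- ‵[1-x+xy]· ‵ 1 ‵+ ‵x· ‵y· ‵ 2)
      (ΔG₁ ‵- ‵x· (‵y· D₁ ‵+ ΔG₁ ‵+ ΔF₂) ∷ ΔG₀ ‵- ‵x· (‵y· D₀ ‵+ ΔG₀ ‵+ ΔF₁) ∷ ‵[1-x]· D₁ ‵- ‵[1-x+xy]· D₀ ∷ [])
      (env j) refl (Dip-step (suc j) ∷ Dip-step j ∷ Down-step j ∷ [])

  D-ΔTop₁ : Null (D· ΔTop 1 ⊖ x· y· [1-x+xy]· 𝟙)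
  D-ΔTop₁ = null-by-identity (‵D· ΔF₁ ‵- ‵x· ‵y· ‵[1-x+xy]· one)
    (‵[1-x]· ‵[1-x]· ‵ 0 ‵+ ‵x· ‵y· ‵[1-x]· ‵ 1 ‵+ ‵x· ‵[1-x]· ‵ 2 ‵+ ‵x· ‵y· ‵[1-x+xy]· ‵ 3)
    (ΔF₁ ‵- ‵x· (ΔF₁ ‵+ ΔF₂ ‵+ ‵y· (G₁ ‵- G₀) ‵+ ‵y· D) ∷ (G₁ ‵- G₀) ‵- ‵x· (‵y· D ‵+ (G₁ ‵- G₀) ‵+ ΔF₁) ∷
     ‵[1-x]· ΔF₂ ‵- ‵[1-x+xy]· ΔF₁ ∷ ‵[1-x]· D ‵- one ∷ [])
    env refl (Top-step 0 ∷ Dip-step 0 ∷ ratio-null (inj₁ 0) ∷ Down₀ ∷ [])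
    where
    F₁ F₂ F₃ G₀ G₁ D one ΔF₁ ΔF₂ : LinExpr
    F₁ = ‵ 0 ; F₂ = ‵ 1 ; F₃ = ‵ 2 ; G₀ = ‵ 3 ; G₁ = ‵ 4 ; D = ‵ 5 ; one = ‵ 6
    ΔF₁ = F₂ ‵- F₁ ; ΔF₂ = F₃ ‵- F₂
    env : ℕ → Seq
    env 0 = Top 1
    env 1 = Top 2
    env 2 = Top 3
    env 3 = Dip 0
    env 4 = Dip 1
    env 5 = Down 0
    env _ = 𝟙

  W-ΔTop₀ : Null (W· ΔTop 0 ⊖ x· [1-2x]· ΔTop 1 ⊖ x· y· 𝟙)
  W-ΔTop₀ = cancel-[1-x] (null-by-identity (‵[1-x]· (‵W· ΔF₀ ‵- ‵x· ‵[1-2x]· ΔF₁ ‵- ‵x· ‵y· one))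
    (‵[1-x]· ‵[1-2x]· ‵ 0 ‵+ ‵x· ‵y· ‵[1-2x]· ‵ 1 ‵+ ‵x· ‵x· ‵y· ‵ 2 ‵+ ‵x· ‵x· ‵y· ‵y· ‵[1-2x]· ‵ 3)
    (ΔF₀ ‵- ‵x· (ΔF₀ ‵+ ΔF₁ ‵+ ‵y· G) ∷ G ‵- one ‵- ‵x· (‵y· S ‵+ G ‵+ F₁) ∷ F₀ ‵- one ‵- ‵x· (F₀ ‵+ F₁) ∷ S ∷ [])
    env refl (Top-step₀ ∷ Dip-recurrence 0 ∷ Top-recurrence₀ ∷ (λ _ _ → refl) ∷ []))
    where
    F₀ F₁ F₂ G S one ΔF₀ ΔF₁ : LinExpr
    F₀ = ‵ 0 ; F₁ = ‵ 1 ; F₂ = ‵ 2 ; G = ‵ 3 ; S = ‵ 4 ; one = ‵ 5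
    ΔF₀ = F₁ ‵- F₀ ; ΔF₁ = F₂ ‵- F₁
    env : ℕ → Seq
    env 0 = Top 0
    env 1 = Top 1
    env 2 = Top 2
    env 3 = Dip 0
    env 4 = Σ< 0 Down
    env _ = 𝟙

  D-ΔTop₀ : Null (D· ΔTop 0 ⊖ x· y· 𝟙)
  D-ΔTop₀ = cancel-W (null-by-identity (‵W· (‵D· ΔF₀ ‵- ‵x· ‵y· one)) (‵x· ‵[1-2x]· ‵ 0 ‵+ ‵D· ‵ 1)
    (‵D· ΔF₁ ‵- ‵x· ‵y· ‵[1-x+xy]· one ∷ ‵W· ΔF₀ ‵- ‵x· ‵[1-2x]· ΔF₁ ‵- ‵x· ‵y· one ∷ [])
    env refl (D-ΔTop₁ ∷ W-ΔTop₀ ∷ []))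
    where
    F₀ F₁ F₂ one ΔF₀ ΔF₁ : LinExpr
    F₀ = ‵ 0 ; F₁ = ‵ 1 ; F₂ = ‵ 2 ; one = ‵ 3
    ΔF₀ = F₁ ‵- F₀ ; ΔF₁ = F₂ ‵- F₁
    env : ℕ → Seq
    env 0 = Top 0
    env 1 = Top 1
    env 2 = Top 2
    env _ = 𝟙

  D-Top₀ : Null (D· Top 0 ⊖ Q· 𝟙)
  D-Top₀ = cancel-[1-2x] (null-by-identity (‵[1-2x]· (‵D· F₀ ‵- ‵Q· one)) (‵D· ‵ 0 ‵+ ‵x· ‵ 1)
    (F₀ ‵- one ‵- ‵x· (F₀ ‵+ F₁) ∷ ‵D· (F₁ ‵- F₀) ‵- ‵x· ‵y· one ∷ [])
    env refl (Top-recurrence₀ ∷ D-ΔTop₀ ∷ []))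
    where
    F₀ F₁ one : LinExpr
    F₀ = ‵ 0 ; F₁ = ‵ 1 ; one = ‵ 2
    env : ℕ → Seq
    env 0 = Top 0
    env 1 = Top 1
    env _ = 𝟙

open PowerSeries
open LinearIdentities
open Avoiding102 using (cnk-p102)
open Avoiding201 using (cnk-p201)
open Series102 using (Asc; D-Asc₀)
open Series201 using (Top; D-Top₀)
open import Data.Sum using (_⊎_; inj₁; inj₂)
open import Data.Bool using (true; false; _∧_; if_then_else_)
open import Data.Integer using (ℤ; +_; _+_; _*_)
open import Data.Integer.Properties using (*-zeroʳ)
open import Data.List using ([]; _∷_; map)
open import Data.List.Relation.Unary.All using ([]; _∷_)
open import Data.Nat using (ℕ; zero; suc; _≤ᵇ_; _∸_)
open import Data.Product using (_×_; _,_)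
open import Relation.Binary.PropositionalEquality using (_≡_; refl; sym; trans; cong; cong₂)

fromTerm : ℤ × ℕ × ℕ → Monomial
fromTerm (a , i , j) = mono 0 i j a

mulSeriesCoeff≈eval : ∀ P F → mulSeriesCoeff P F ≈ eval (map fromTerm P) (λ _ → F)
mulSeriesCoeff≈eval []                F L k = refl
mulSeriesCoeff≈eval ((a , i , j) ∷ P) F L k =
  cong₂ _+_ (scale ((i ≤ᵇ L) ∧ (j ≤ᵇ k))) (mulSeriesCoeff≈eval P F L k)
  where
  scale : ∀ b → (if b then a * F (L ∸ i) (k ∸ j) else + 0) ≡ a * (if b then F (L ∸ i) (k ∸ j) else + 0)
  scale true  = refl
  scale false = sym (*-zeroʳ a)

mulSeriesCoeff-denom : ∀ F → mulSeriesCoeff denom F ≈ D· F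
mulSeriesCoeff-denom F L k =
  trans (mulSeriesCoeff≈eval denom F L k)
        (trans (eval-identity (map fromTerm denom) (monomials (‵D· ‵ 0)) refl (λ _ → F) L k)
               (sym (monomials-sound (‵D· ‵ 0) (λ _ → F) L k)))

numer-coefficients : ∀ n k → (D· 𝟙 ⊕ x· Q· 𝟙) n k ≡ polyCoeff numer n k
numer-coefficients 0                         0             = refl
numer-coefficients 0                         1             = refl
numer-coefficients 0                         (suc (suc k)) = refl
numer-coefficients 1                         0             = refl
numer-coefficients 1                         1             = refl
numer-coefficients 1                         (suc (suc k)) = refl
numer-coefficients 2                         0             = refl
numer-coefficients 2                         1             = refl
numer-coefficients 2                         (suc (suc k)) = refl
numer-coefficients 3                         0             = refl
numer-coefficients 3                         1             = refl
numer-coefficients 3                         (suc (suc k)) = refl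
numer-coefficients (suc (suc (suc (suc n)))) 0             = refl
numer-coefficients (suc (suc (suc (suc n)))) 1             = refl
numer-coefficients (suc (suc (suc (suc n)))) (suc (suc k)) = refl

-- If C = 1 + x R and D R = Q, then D C = D + x Q, which is the numerator.
mulSeriesCoeff-denom≡numer : ∀ C R → Null (C ⊖ 𝟙 ⊖ x· R) → Null (D· R ⊖ Q· 𝟙) →
                             ∀ n k → mulSeriesCoeff denom C n k ≡ polyCoeff numer n k
mulSeriesCoeff-denom≡numer C R C-rec D-R n k =
  trans (mulSeriesCoeff-denom C n k) (trans (null⇒≈ {D· C} {D· 𝟙 ⊕ x· Q· 𝟙} D-C n k) (numer-coefficients n k))
  where
  D-C : Null (D· C ⊖ (D· 𝟙 ⊕ x· Q· 𝟙))
  D-C = null-by-identity (‵D· ‵ 0 ‵- (‵D· ‵ 2 ‵+ ‵x· ‵Q· ‵ 2)) (‵D· ‵ 0 ‵+ ‵x· ‵ 1)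
    (‵ 0 ‵- ‵ 2 ‵- ‵x· ‵ 1 ∷ ‵D· ‵ 1 ‵- ‵Q· ‵ 2 ∷ [])
    env refl (C-rec ∷ D-R ∷ [])
    where
    env : ℕ → Seq
    env 0 = C
    env 1 = R
    env _ = 𝟙

counts : Word → Seq
counts p n k = + cnk p n k

counts-102 : Null (counts p102 ⊖ 𝟙 ⊖ x· Asc 0)
counts-102 = recurrence-null (counts p102) (Asc 0) (λ { zero → refl ; (suc _) → refl }) (λ L k → cong +_ (cnk-p102 L k))

counts-201 : Null (counts p201 ⊖ 𝟙 ⊖ x· Top 0)
counts-201 = recurrence-null (counts p201) (Top 0) (λ { zero → refl ; (suc _) → refl }) (λ L k → cong +_ (cnk-p201 L k))

theorem7 : (p : Word) → p ≡ p102 ⊎ p ≡ p201 →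
    (n k : ℕ) → mulSeriesCoeff denom (λ m j → + cnk p m j) n k ≡ polyCoeff numer n k
theorem7 p (inj₁ refl) = mulSeriesCoeff-denom≡numer (counts p102) (Asc 0) counts-102 D-Asc₀
theorem7 p (inj₂ refl) = mulSeriesCoeff-denom≡numer (counts p201) (Top 0) counts-201 D-Top₀
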